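{- Let $G$ be a finite graph (loops and multiple edges allowed) with $n$ vertices and $m$ edges. The extended polychromate $\overline\chi_G$ and the extended Tutte symmetric function $\overline Y_G$ are equivalent. More precisely, for each $\overline\tau=((a_1,b_1),\ldots,(a_k,b_k))\vdash(n,m)$, the coefficient of $\overline m_{\overline\tau}(\mathbf x,\mathbf t)$ in the expansion of $\overline Y_G$ in the basis $\{\overline m_{\overline\tau}\}$ equals the coefficient of $\overline{\mathbf x}(\overline\tau)=x_{a_1,b_1}\cdots x_{a_k,b_k}$ in $\overline\chi_G$.
   Context: Let $V=\{v_1,\ldots,v_n\}$ be the vertex set. An integer pair partition of $(a,b)$, written $\overline\tau\vdash(a,b)$, is a list $((a_1,b_1),\ldots,(a_k,b_k))$ with $(a_1,\ldots,a_k)$ an integer partition of $a$, each $b_i\in\mathbb Z^{\ge0}$, $\sum b_i\le b$, pairs in lexicographically decreasing order. For a partition $\pi$ of $V$, $\overline\tau(\pi)$ is the integer pair partition whose pairs are, for each block, (number of vertices in the block, number of edges with both endpoints in the block), in lexicographically decreasing order. The extended polychromate, in commuting variables $x_{i,j}$ ($i\in\mathbb Z^{>0}$, $j\in\mathbb Z^{\ge0}$), is $\overline\chi_G=\sum_\pi\overline{\mathbf x}(\overline\tau(\pi))$ over all partitions $\pi$ of $V$, where $\overline{\mathbf x}((a_1,b_1),\ldots,(a_k,b_k))=x_{a_1,b_1}\cdots x_{a_k,b_k}$. The extended Tutte symmetric function is $\overline{Y}_G(\mathbf x,\mathbf t)=\sum_{\chi}(\prod_{i=1}^n x_{\chi(v_i)})(\prod_{i\ge1}(1+t_i)^{b_i(\chi)})$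 over all $\chi:V\to\mathbb Z^{>0}$, with $b_i(\chi)$ the number of edges both of whose endpoints have colour $i$. For $\overline\tau=((a_1,b_1),\ldots,(a_k,b_k))$, $\overline m_{\overline\tau}(\mathbf x,\mathbf t)=\sum x_{i_1}^{a_1}(1+t_{i_1})^{b_1}\cdots x_{i_k}^{a_k}(1+t_{i_k})^{b_k}$, summed over all $k$-tuples of pairwise distinct positive integers $(i_1,\ldots,i_k)$; these form a basis (the augmented monomial basis) of the paired symmetric functions. A function $P$ specializes to $Q$ if the coefficients of $Q_G$ (relative to a chosen basis in the symmetric-function case) can be obtained as functions of those of $P_G$ and the number of vertices; $P,Q$ are equivalent if each specializes to the other. -}

module Defs where

open import Data.Nat using (ℕ; zero; suc; _+_; _*_; _≤_; _<_; _≤?_; _<?_)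
open import Data.Nat.Properties using () renaming (_≟_ to _≟ℕ_)
open import Data.Nat.Combinatorics using (_C_)
open import Data.Integer using (ℤ; +_) renaming (_+_ to _+ℤ_; _*_ to _*ℤ_)
open import Data.Fin using (Fin; toℕ) renaming (_≟_ to _≟F_)
open import Data.Fin.Properties using (all?)
open import Data.Vec using (Vec; []; _∷_; lookup; toList)
open import Data.Nat.ListAction using (sum; product)
open import Data.List using (List; []; _∷_; map; length; zip; filter; concatMap; upTo; allFin; foldr)
open import Data.List.Relation.Unary.All using (All) renaming (all? to allL?)
open import Data.List.Relation.Unary.Linked using (Linked; linked?)
open import Data.Maybe using (Maybe; just; nothing)
open import Data.Product using (_×_; _,_; proj₁; proj₂)
open import Data.Product.Properties using (≡-dec)
open import Data.Sum using (_⊎_)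
open import Data.Bool using (Bool; true; false; if_then_else_; _∧_; T)
open import Relation.Nullary using (Dec; yes; no)
open import Relation.Nullary.Decidable using (⌊_⌋; _×-dec_; _⊎-dec_)
open import Relation.Binary.PropositionalEquality using (_≡_)
import Data.List.Relation.Unary.Unique.DecPropositional as UDec

-- A finite graph G (loops and multiple edges allowed) with n vertices and
-- m edges is given by  ends : Fin m → Fin n × Fin n  (edge e joins the two
-- listed vertices; a loop has equal endpoints).
--
-- Power series in the commuting variables x_1, x_2, …, t_1, t_2, … are
-- compared coefficientwise.  Every monomial involves only finitely many
-- indices, so it is x^α t^β for some N and α β : Fin N → ℕ (the exponents
-- of x_1..x_N and t_1..t_N, all other exponents zero).

Pair : Set
Pair = ℕ × ℕ

countFin : (k : ℕ) → (Fin k → Bool) → ℕ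
countFin k p = sum (map (λ i → if p i then 1 else 0) (allFin k))

prodFin : (k : ℕ) → (Fin k → ℕ) → ℕ
prodFin k f = product (map f (allFin k))

vecs : (N k : ℕ) → List (Vec (Fin N) k)
vecs N zero    = [] ∷ []
vecs N (suc k) = concatMap (λ i → map (i ∷_) (vecs N k)) (allFin N)

sumℤ : List ℤ → ℤ
sumℤ = foldr _+ℤ_ (+ 0)

-- Coefficient of x^α t^β in the extended Tutte symmetric function
--   Ybar_G = Σ_χ (Π_v x_{χ(v)}) Π_i (1+t_i)^{b_i(χ)}.
-- A colouring using a colour > N contributes a positive power of some
-- x_j with j > N, hence nothing to x^α t^β; so only χ : V → {1..N}
-- matter.  The coefficient of t^β in Π_i (1+t_i)^{b_i} is Π_i C(b_i,β_i).

colourClassSize : (n N : ℕ) → Vec (Fin N) n → Fin N → ℕ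
colourClassSize n N χ i = countFin n (λ v → ⌊ lookup χ v ≟F i ⌋)

monoEdges : (n m N : ℕ) → (Fin m → Fin n × Fin n) → Vec (Fin N) n → Fin N → ℕ
monoEdges n m N ends χ i =
  countFin m (λ e → ⌊ lookup χ (proj₁ (ends e)) ≟F i ⌋ ∧ ⌊ lookup χ (proj₂ (ends e)) ≟F i ⌋)

coeffY : (n m : ℕ) → (Fin m → Fin n × Fin n) → (N : ℕ) → (α β : Fin N → ℕ) → ℕ
coeffY n m ends N α β = sum (map term (vecs N n))
  where
  term : Vec (Fin N) n → ℕ
  term χ = if ⌊ all? (λ i → α i ≟ℕ colourClassSize n N χ i) ⌋
           then prodFin N (λ i → monoEdges n m N ends χ i C β i)
           else 0

_≥lex_ : Pair → Pair → Set
(a , b) ≥lex (a' , b') = (a' < a) ⊎ ((a ≡ a') × (b' ≤ b))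

_≥lex?_ : (p q : Pair) → Dec (p ≥lex q)
(a , b) ≥lex? (a' , b') = (a' <? a) ⊎-dec ((a ≟ℕ a') ×-dec (b' ≤? b))

-- τ = ((a_1,b_1),…,(a_k,b_k)) ⊢ (a , b):  (a_1,…,a_k) is an integer
-- partition of a (positive parts, weakly decreasing — implied by the lex
-- order — summing to a), Σ b_i ≤ b, pairs lexicographically decreasing.
IsIPP : ℕ → ℕ → List Pair → Set
IsIPP a b τ = All (λ p → 1 ≤ proj₁ p) τ
            × (sum (map proj₁ τ) ≡ a)
            × (sum (map proj₂ τ) ≤ b)
            × Linked _≥lex_ τ

isIPP? : (a b : ℕ) → (τ : List Pair) → Dec (IsIPP a b τ)
isIPP? a b τ = allL? (λ p → 1 ≤? proj₁ p) τ
             ×-dec ((sum (map proj₁ τ) ≟ℕ a)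
             ×-dec ((sum (map proj₂ τ) ≤? b)
             ×-dec linked? _≥lex?_ τ))

listsOf : {A : Set} → ℕ → List A → List (List A)
listsOf zero    xs = [] ∷ []
listsOf (suc L) xs = concatMap (λ x → map (x ∷_) (listsOf L xs)) xs

-- the list of all τ ⊢ (a , b), each exactly once: such τ has length ≤ a,
-- entries with first component in 1..a and second in 0..b.
ipps : ℕ → ℕ → List (List Pair)
ipps a b = filter (isIPP? a b) (concatMap (λ L → listsOf L alphabet) (upTo (suc a)))
  where
  alphabet : List Pair
  alphabet = concatMap (λ x → map (λ y → (x , y)) (upTo (suc b))) (map suc (upTo a))

-- Coefficient of x^α t^β in the augmented monomial
--   mbar_τ = Σ_{(i_1..i_k) pairwise distinct} Π_j x_{i_j}^{a_j} (1+t_{i_j})^{b_j}.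
-- (Used for τ an integer pair partition, so every a_j ≥ 1: a tuple using an
-- index > N contributes a positive power of some x_j, j > N, hence nothing.)

coeffM : List Pair → (N : ℕ) → (α β : Fin N → ℕ) → ℕ
coeffM τ N α β = sum (map term (vecs N (length τ)))
  where
  term : Vec (Fin N) (length τ) → ℕ
  term ι = if ⌊ UDec.unique? _≟F_ (toList ι) ⌋
                ∧ ⌊ all? (λ i → α i ≟ℕ xExp i) ⌋
           then prodFin N (λ i → tExp i C β i)
           else 0
    where
    assigned : List (Pair × Fin N)
    assigned = zip τ (toList ι)
    xExp : Fin N → ℕ
    xExp i = sum (map (λ q → if ⌊ proj₂ q ≟F i ⌋ then proj₁ (proj₁ q) else 0) assigned)
    tExp : Fin N → ℕ
    tExp i = sum (map (λ q → if ⌊ proj₂ q ≟F i ⌋ then proj₂ (proj₁ q) else 0) assigned)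

IsAugMonomialExpansion : (n m : ℕ) → (Fin m → Fin n × Fin n) → (List Pair → ℤ) → Set
IsAugMonomialExpansion n m ends c =
  (N : ℕ) (α β : Fin N → ℕ) →
  + coeffY n m ends N α β ≡ sumℤ (map (λ τ → c τ *ℤ + coeffM τ N α β) (ipps n m))

-- Set partitions of V = Fin n, represented (bijectively) by restricted
-- growth strings r : V → ℕ (r v = index of the block of v; r_0 = 0 and
-- r_i ≤ 1 + max_{j<i} r_j).  rgs k xs returns the total number of blocks
-- if xs is a restricted growth continuation after k labels were used.

rgs : ℕ → List ℕ → Maybe ℕ
rgs k [] = just k
rgs k (x ∷ xs) with x <? k | x ≟ℕ k
... | yes _ | _     = rgs k xs
... | no _  | yes _ = rgs (suc k) xs
... | no _  | no _  = nothing

-- τ(π) up to order: list of (block size, edges inside the block)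
blockPairs : (n m : ℕ) → (Fin m → Fin n × Fin n) → Vec (Fin n) n → ℕ → List Pair
blockPairs n m ends r k = map pr (upTo k)
  where
  lab : Fin n → ℕ
  lab v = toℕ (lookup r v)
  pr : ℕ → Pair
  pr ℓ = countFin n (λ v → ⌊ lab v ≟ℕ ℓ ⌋)
       , countFin m (λ e → ⌊ lab (proj₁ (ends e)) ≟ℕ ℓ ⌋ ∧ ⌊ lab (proj₂ (ends e)) ≟ℕ ℓ ⌋)

-- equality of the commutative monomials xbar(p) and xbar(q): p, q are
-- equal as multisets
removeOne : Pair → List Pair → Maybe (List Pair)
removeOne p [] = nothing
removeOne p (q ∷ qs) with ≡-dec _≟ℕ_ _≟ℕ_ p q
... | yes _ = just qs
... | no _  with removeOne p qs
...   | nothing  = nothing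
...   | just qs' = just (q ∷ qs')

sameMonomial : List Pair → List Pair → Bool
sameMonomial [] []      = true
sameMonomial [] (_ ∷ _) = false
sameMonomial (p ∷ ps) qs with removeOne p qs
... | nothing  = false
... | just qs' = sameMonomial ps qs'

-- Coefficient of xbar(τ) in  chibar_G = Σ_π xbar(τ(π)):
-- the number of set partitions π of V whose monomial equals xbar(τ).
coeffChi : (n m : ℕ) → (Fin m → Fin n × Fin n) → List Pair → ℕ
coeffChi n m ends τ = sum (map term (vecs n n))
  where
  term : Vec (Fin n) n → ℕ
  term r with rgs 0 (map toℕ (toList r))
  ... | nothing = 0
  ... | just k  = if sameMonomial (blockPairs n m ends r k) τ then 1 else 0

-- Group the colourings χ : V → {1,…,N} in Ybar_G by their partition π into colour classes.  The
-- colourings with partition π are the injective colourings of the blocks of π, and the edges counted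
-- by b_i(χ) are those inside the block of colour i, so together they contribute exactly mbar_{τ(π)}:
-- Ybar_G = Σ_π mbar_{τ(π)}, whose coefficients are those of chibar_G.  Conversely the mbar_τ with
-- τ ⊢ (n, m) are linearly independent.  At the monomial x_1^{a_1} t_1^{b_1} ⋯ x_k^{a_k} t_k^{b_k} of τ
-- the coefficient of mbar_σ vanishes unless Σ b(σ) ≥ Σ b(τ), with equality only for σ = τ, and that of
-- mbar_τ is nonzero, so the expansion is unique by induction on m − Σ b(τ).

module Submission where

open import Algebra.Properties.CommutativeSemigroup using (interchange)
open import Data.Bool using (Bool; true; false; if_then_else_; _∧_)
open import Data.Empty using (⊥-elim)
open import Data.Fin using (Fin; zero; suc; toℕ) renaming (_≟_ to _≟F_)
open import Data.Fin.Properties using (all?)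
open import Data.List using (List; []; _∷_; map; _++_; length; allFin; concatMap; filter; upTo; zip)
import Data.List as List
import Data.List.Properties as Listₚ
open import Data.List.Properties
  using (map-cong; map-cong-local; map-∘; map-++; map-id; map-tabulate; map-applyUpTo; ++-assoc; ++-identityʳ;
         length-++; length-map; length-upTo; zip-map)
open import Data.List.Membership.Propositional using (_∈_; _∉_; lose; find)
open import Data.List.Membership.Propositional.Properties
  using (∈-allFin; ∈-lookup; ∈-map⁺; ∈-map⁻; ∈-concatMap⁺; ∈-concatMap⁻; ∈-upTo⁺; ∈-upTo⁻; ∈-filter⁻)
open import Data.List.Membership.Propositional.Properties.WithK using (unique∧set⇒bag)
open import Data.List.Relation.Binary.BagAndSetEquality using (∼bag⇒↭)
open import Data.List.Relation.Binary.Permutation.Propositional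
  using (_↭_; ↭⇒↭ₛ; ↭-refl; ↭-prep; ↭-swap; ↭-sym; ↭-trans)
import Data.List.Relation.Binary.Permutation.Propositional as ↭
open import Data.List.Relation.Binary.Permutation.Propositional.Properties
  using (∈-resp-↭; drop-∷; ↭-length; map⁺; ++⁺ˡ; ++⁺ʳ; All-resp-↭)
import Data.List.Relation.Binary.Permutation.Setoid.Properties as PermutationSetoid
open import Data.List.Relation.Binary.Pointwise using (Pointwise-≡⇒≡)
open import Data.List.Relation.Unary.All using (All; []; _∷_)
import Data.List.Relation.Unary.All as All
import Data.List.Relation.Unary.All.Properties as Allₚ
open import Data.List.Relation.Unary.Any using (here; there)
open import Data.List.Relation.Unary.Linked using (Linked)
open import Data.List.Relation.Unary.Sorted.TotalOrder.Properties using (↗↭↗⇒≋)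
open import Data.List.Relation.Unary.Unique.Propositional using (Unique; []; _∷_)
import Data.List.Relation.Unary.Unique.DecPropositional as UniqueDec
open import Data.List.Relation.Unary.Unique.Propositional.Properties using (allFin⁺; upTo⁺; Unique[x∷xs]⇒x∉xs)
import Data.List.Relation.Unary.Unique.Propositional.Properties as Unique
open import Data.Maybe using (Maybe; just; nothing; maybe′)
import Data.Maybe as Maybe
open import Data.Maybe.Properties using (just-injective)
open import Data.Nat using (ℕ; zero; suc; _+_; _*_; _∸_; _≤_; _<_; z≤n; s≤s; _<?_)
open import Data.Nat.Combinatorics using (_C_; nCn≡1; k>n⇒nCk≡0)
open import Data.Nat.Induction using (<-rec)
open import Data.Nat.ListAction using (sum; product)
open import Data.Nat.ListAction.Properties using (sum-++; sum-↭)
open import Data.Nat.Properties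
open import Data.Product using (∃; _×_; _,_; proj₁; proj₂)
open import Data.Product.Properties using (≡-dec)
open import Data.Sum using (_⊎_; inj₁; inj₂)
open import Data.Vec using (Vec; []; _∷_; toList)
import Data.Vec as Vec
import Data.Vec.Properties as Vecₚ
open import Function using (_∘_; id)
open import Function.Bundles using (_⇔_; mk⇔)
open import Level using (0ℓ)
open import Relation.Binary.Bundles using (DecTotalOrder)
open import Relation.Binary.Definitions using (DecidableEquality; tri<; tri≈; tri>)
open import Relation.Binary.PropositionalEquality
open import Relation.Binary.Structures using (IsDecTotalOrder)
open import Relation.Nullary using (Dec; yes; no; ¬_)
open import Relation.Nullary.Decidable using (⌊_⌋)

open import Defs

private variable
  A B : Set

sum-map-cong : {f g : A → ℕ} (xs : List A) → (∀ x → f x ≡ g x) → sum (map f xs) ≡ sum (map g xs)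
sum-map-cong xs h = cong sum (map-cong h xs)

sum-map-zero : {f : A → ℕ} (xs : List A) → (∀ x → x ∈ xs → f x ≡ 0) → sum (map f xs) ≡ 0
sum-map-zero []       h = refl
sum-map-zero (x ∷ xs) h = cong₂ _+_ (h x (here refl)) (sum-map-zero xs (λ y p → h y (there p)))

sum-map-map : (f : B → ℕ) (g : A → B) (xs : List A) → sum (map f (map g xs)) ≡ sum (map (f ∘ g) xs)
sum-map-map f g xs = cong sum (sym (map-∘ xs))

sum-map-++ : (f : A → ℕ) (xs ys : List A) → sum (map f (xs ++ ys)) ≡ sum (map f xs) + sum (map f ys)
sum-map-++ f xs ys = trans (cong sum (map-++ f xs ys)) (sum-++ (map f xs) (map f ys))

sum-map-concatMap : (f : B → ℕ) (g : A → List B) (xs : List A) →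
  sum (map f (concatMap g xs)) ≡ sum (map (λ x → sum (map f (g x))) xs)
sum-map-concatMap f g []       = refl
sum-map-concatMap f g (x ∷ xs) =
  trans (sum-map-++ f (g x) (concatMap g xs)) (cong (sum (map f (g x)) +_) (sum-map-concatMap f g xs))

sum-map-+ : (f g : A → ℕ) (xs : List A) →
  sum (map (λ x → f x + g x) xs) ≡ sum (map f xs) + sum (map g xs)
sum-map-+ f g []       = refl
sum-map-+ f g (x ∷ xs) =
  trans (cong (f x + g x +_) (sum-map-+ f g xs)) (interchange +-commutativeSemigroup (f x) (g x) (sum (map f xs)) (sum (map g xs)))

sum-map-*ˡ : (c : ℕ) (f : A → ℕ) (xs : List A) → sum (map (λ x → c * f x) xs) ≡ c * sum (map f xs)
sum-map-*ˡ c f []       = sym (*-zeroʳ c)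
sum-map-*ˡ c f (x ∷ xs) = trans (cong (c * f x +_) (sum-map-*ˡ c f xs)) (sym (*-distribˡ-+ c (f x) _))

sum-map-*ʳ : (c : ℕ) (f : A → ℕ) (xs : List A) → sum (map (λ x → f x * c) xs) ≡ sum (map f xs) * c
sum-map-*ʳ c f xs = trans (sum-map-cong xs (λ x → *-comm (f x) c)) (trans (sum-map-*ˡ c f xs) (*-comm c _))

sum-map-swap : (f : A → B → ℕ) (xs : List A) (ys : List B) →
  sum (map (λ x → sum (map (f x) ys)) xs) ≡ sum (map (λ y → sum (map (λ x → f x y) xs)) ys)
sum-map-swap f []       ys = sym (sum-map-zero ys (λ _ _ → refl))
sum-map-swap f (x ∷ xs) ys = trans (cong (sum (map (f x) ys) +_) (sum-map-swap f xs ys))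
  (sym (sum-map-+ (f x) (λ y → sum (map (λ x → f x y) xs)) ys))

sum-map-mono-≤ : {f g : A → ℕ} (xs : List A) → (∀ x → x ∈ xs → f x ≤ g x) →
  sum (map f xs) ≤ sum (map g xs)
sum-map-mono-≤ []       h = z≤n
sum-map-mono-≤ (x ∷ xs) h = +-mono-≤ (h x (here refl)) (sum-map-mono-≤ xs (λ y p → h y (there p)))

∈⇒≤-sum-map : (f : A → ℕ) {x : A} (xs : List A) → x ∈ xs → f x ≤ sum (map f xs)
∈⇒≤-sum-map f (y ∷ xs) (here refl) = m≤m+n (f y) _
∈⇒≤-sum-map f (y ∷ xs) (there p)   = ≤-trans (∈⇒≤-sum-map f xs p) (m≤n+m _ (f y))

sum-map≢0⇒∃ : (f : A → ℕ) (xs : List A) → ¬ sum (map f xs) ≡ 0 → ∃ λ x → x ∈ xs × ¬ f x ≡ 0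
sum-map≢0⇒∃ f []       h = ⊥-elim (h refl)
sum-map≢0⇒∃ f (x ∷ xs) h with f x ≟ 0
... | no fx≢0 = x , here refl , fx≢0
... | yes fx≡0 with sum-map≢0⇒∃ f xs (λ e → h (cong₂ _+_ fx≡0 e))
...   | y , y∈xs , fy≢0 = y , there y∈xs , fy≢0

sum-map-mono-≤-≡⇒≡ : {f g : A → ℕ} (xs : List A) → (∀ x → x ∈ xs → f x ≤ g x) →
  sum (map f xs) ≡ sum (map g xs) → ∀ x → x ∈ xs → f x ≡ g x
sum-map-mono-≤-≡⇒≡ {f = f} {g} (y ∷ xs) f≤g Σ≡ x x∈ = go x∈
  where
  rest≤ : sum (map f xs) ≤ sum (map g xs)
  rest≤ = sum-map-mono-≤ xs (λ z p → f≤g z (there p))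
  head≡ : f y ≡ g y
  head≡ = ≤-antisym (f≤g y (here refl))
    (+-cancelʳ-≤ (sum (map g xs)) (g y) (f y) (≤-trans (≤-reflexive (sym Σ≡)) (+-monoʳ-≤ (f y) rest≤)))
  go : x ∈ y ∷ xs → f x ≡ g x
  go (here refl) = head≡
  go (there p)   = sum-map-mono-≤-≡⇒≡ xs (λ z q → f≤g z (there q))
    (+-cancelˡ-≡ (f y) _ _ (trans Σ≡ (cong (_+ sum (map g xs)) (sym head≡)))) x p

sum-map-allFin-suc : (n : ℕ) (f : Fin (suc n) → ℕ) →
  sum (map f (allFin (suc n))) ≡ f zero + sum (map (f ∘ suc) (allFin n))
sum-map-allFin-suc n f =
  cong (f zero +_) (trans (cong sum (map-tabulate suc f)) (sym (cong sum (map-tabulate id (f ∘ suc)))))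

product-map-1 : (f : A → ℕ) (xs : List A) → (∀ x → x ∈ xs → f x ≡ 1) → product (map f xs) ≡ 1
product-map-1 f []       h = refl
product-map-1 f (x ∷ xs) h = cong₂ _*_ (h x (here refl)) (product-map-1 f xs (λ y p → h y (there p)))

product-map≢0⇒≢0 : (f : A → ℕ) (xs : List A) → ¬ product (map f xs) ≡ 0 → ∀ x → x ∈ xs → ¬ f x ≡ 0
product-map≢0⇒≢0 f (y ∷ xs) h x (here refl) e = h (cong (_* product (map f xs)) e)
product-map≢0⇒≢0 f (y ∷ xs) h x (there p)   e =
  product-map≢0⇒≢0 f xs (λ z → h (trans (cong (f y *_) z) (*-zeroʳ (f y)))) x p e

𝟙[_] : Bool → ℕ
𝟙[ b ] = if b then 1 else 0

⌊⌋-cong-⇔ : {P Q : Set} (p? : Dec P) (q? : Dec Q) → (P → Q) → (Q → P) → ⌊ p? ⌋ ≡ ⌊ q? ⌋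
⌊⌋-cong-⇔ (yes p) (yes q) f g = refl
⌊⌋-cong-⇔ (yes p) (no ¬q) f g = ⊥-elim (¬q (f p))
⌊⌋-cong-⇔ (no ¬p) (yes q) f g = ⊥-elim (¬p (g q))
⌊⌋-cong-⇔ (no ¬p) (no ¬q) f g = refl

𝟙-yes : {P : Set} (p? : Dec P) → P → 𝟙[ ⌊ p? ⌋ ] ≡ 1
𝟙-yes (yes _) _ = refl
𝟙-yes (no ¬p) p = ⊥-elim (¬p p)

𝟙-no : {P : Set} (p? : Dec P) → ¬ P → 𝟙[ ⌊ p? ⌋ ] ≡ 0
𝟙-no (yes p) ¬p = ⊥-elim (¬p p)
𝟙-no (no _)  _  = refl

𝟙-⇔× : {P Q R : Set} (p? : Dec P) (q? : Dec Q) (r? : Dec R) → (P → Q × R) → (Q → R → P) →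
  𝟙[ ⌊ p? ⌋ ] ≡ 𝟙[ ⌊ q? ⌋ ] * 𝟙[ ⌊ r? ⌋ ]
𝟙-⇔× (yes p) (yes q) (yes r) f g = refl
𝟙-⇔× (yes p) (no ¬q) r?      f g = ⊥-elim (¬q (proj₁ (f p)))
𝟙-⇔× (yes p) (yes q) (no ¬r) f g = ⊥-elim (¬r (proj₂ (f p)))
𝟙-⇔× (no ¬p) (yes q) (yes r) f g = ⊥-elim (¬p (g q r))
𝟙-⇔× (no ¬p) (yes q) (no ¬r) f g = refl
𝟙-⇔× (no ¬p) (no ¬q) r?      f g = refl

multiplicity : DecidableEquality A → A → List A → ℕ
multiplicity _≟A_ y xs = sum (map (λ x → 𝟙[ ⌊ x ≟A y ⌋ ]) xs)

sum-map-supported-at : (_≟A_ : DecidableEquality A) (y : A) (f : A → ℕ) (xs : List A) →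
  (∀ x → x ∈ xs → ¬ x ≡ y → f x ≡ 0) → sum (map f xs) ≡ multiplicity _≟A_ y xs * f y
sum-map-supported-at _≟A_ y f []       h = refl
sum-map-supported-at _≟A_ y f (x ∷ xs) h with x ≟A y
... | yes refl = cong (f x +_) (sum-map-supported-at _≟A_ y f xs (λ z p → h z (there p)))
... | no x≢y   = cong₂ _+_ (h x (here refl) x≢y) (sum-map-supported-at _≟A_ y f xs (λ z p → h z (there p)))

multiplicity-∉ : (_≟A_ : DecidableEquality A) {y : A} (xs : List A) → y ∉ xs → multiplicity _≟A_ y xs ≡ 0
multiplicity-∉ _≟A_ {y} xs y∉ = sum-map-zero xs (λ x p → 𝟙-no (x ≟A y) (λ { refl → y∉ p }))

multiplicity-unique : (_≟A_ : DecidableEquality A) {y : A} (xs : List A) → Unique xs → y ∈ xs →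
  multiplicity _≟A_ y xs ≡ 1
multiplicity-unique _≟A_ (x ∷ xs) u@(_ ∷ _) (here refl) =
  cong₂ _+_ (𝟙-yes (x ≟A x) refl) (multiplicity-∉ _≟A_ xs (Unique[x∷xs]⇒x∉xs u))
multiplicity-unique _≟A_ {y} (x ∷ xs) u@(_ ∷ u′) (there p) =
  cong₂ _+_ (𝟙-no (x ≟A y) (λ { refl → Unique[x∷xs]⇒x∉xs u p })) (multiplicity-unique _≟A_ xs u′ p)

multiplicity-allFin : (n : ℕ) (i : Fin n) → multiplicity _≟F_ i (allFin n) ≡ 1
multiplicity-allFin n i = multiplicity-unique _≟F_ (allFin n) (allFin⁺ n) (∈-allFin i)

multiplicity-filter : (_≟A_ : DecidableEquality A) {P : A → Set} (P? : (a : A) → Dec (P a)) {y : A} → P y →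
  (xs : List A) → multiplicity _≟A_ y (filter P? xs) ≡ multiplicity _≟A_ y xs
multiplicity-filter _≟A_ P? py []       = refl
multiplicity-filter _≟A_ P? {y} py (x ∷ xs) with P? x
... | yes _  = cong (_ +_) (multiplicity-filter _≟A_ P? py xs)
... | no ¬px = trans (multiplicity-filter _≟A_ P? py xs)
                     (cong (_+ multiplicity _≟A_ y xs) (sym (𝟙-no (x ≟A y) (λ { refl → ¬px py }))))

sum-map-1 : (xs : List A) → sum (map (λ _ → 1) xs) ≡ length xs
sum-map-1 []       = refl
sum-map-1 (_ ∷ xs) = cong suc (sum-map-1 xs)

𝟙-∧-≤ˡ : (a b : Bool) → 𝟙[ a ∧ b ] ≤ 𝟙[ a ]
𝟙-∧-≤ˡ true  true  = ≤-refl
𝟙-∧-≤ˡ true  false = z≤n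
𝟙-∧-≤ˡ false b     = z≤n

sum-map-vecs-suc : (N k : ℕ) (f : Vec (Fin N) (suc k) → ℕ) →
  sum (map f (vecs N (suc k))) ≡ sum (map (λ i → sum (map (λ v → f (i ∷ v)) (vecs N k))) (allFin N))
sum-map-vecs-suc N k f = trans (sum-map-concatMap f (λ i → map (i ∷_) (vecs N k)) (allFin N))
  (sum-map-cong (allFin N) (λ i → sum-map-map f (i ∷_) (vecs N k)))

∈-vecs : (N k : ℕ) (v : Vec (Fin N) k) → v ∈ vecs N k
∈-vecs N zero    []      = here refl
∈-vecs N (suc k) (i ∷ v) = ∈-concatMap⁺ _ (lose (∈-allFin i) (∈-map⁺ (i ∷_) (∈-vecs N k v)))

listsOf-length : {w : List A} (L : ℕ) (xs : List A) → w ∈ listsOf L xs → length w ≡ L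
listsOf-length zero    xs (here refl) = refl
listsOf-length (suc L) xs w∈ with find (∈-concatMap⁻ (λ x → map (x ∷_) (listsOf L xs)) {xs = xs} w∈)
... | x , _ , w∈x∷ with ∈-map⁻ (x ∷_) w∈x∷
...   | w′ , w′∈ , refl = cong suc (listsOf-length L xs w′∈)

multiplicity-listsOf : {A : Set} (_≟A_ : DecidableEquality A) (ys xs : List A) →
  multiplicity (Listₚ.≡-dec _≟A_) ys (listsOf (length ys) xs) ≡ product (map (λ y → multiplicity _≟A_ y xs) ys)
multiplicity-listsOf _≟A_ []       xs = refl
multiplicity-listsOf {A} _≟A_ (y ∷ ys) xs = begin
    multiplicity _≟L_ (y ∷ ys) (concatMap (λ x → map (x ∷_) tails) xs)
  ≡⟨ sum-map-concatMap is (λ x → map (x ∷_) tails) xs ⟩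
    sum (map (λ x → sum (map is (map (x ∷_) tails))) xs)
  ≡⟨ sum-map-cong xs (λ x → sum-map-map is (x ∷_) tails) ⟩
    sum (map (λ x → sum (map (λ w → is (x ∷ w)) tails)) xs)
  ≡⟨ sum-map-cong xs (λ x → sum-map-cong tails (λ w → 𝟙-⇔× ((x ∷ w) ≟L (y ∷ ys)) (x ≟A y) (w ≟L ys)
        (λ e → Listₚ.∷-injectiveˡ e , Listₚ.∷-injectiveʳ e) (λ { refl refl → refl }))) ⟩
    sum (map (λ x → sum (map (λ w → 𝟙[ ⌊ x ≟A y ⌋ ] * 𝟙[ ⌊ w ≟L ys ⌋ ]) tails)) xs)
  ≡⟨ sum-map-cong xs (λ x → sum-map-*ˡ 𝟙[ ⌊ x ≟A y ⌋ ] (λ w → 𝟙[ ⌊ w ≟L ys ⌋ ]) tails) ⟩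
    sum (map (λ x → 𝟙[ ⌊ x ≟A y ⌋ ] * multiplicity _≟L_ ys tails) xs)
  ≡⟨ sum-map-*ʳ (multiplicity _≟L_ ys tails) (λ x → 𝟙[ ⌊ x ≟A y ⌋ ]) xs ⟩
    multiplicity _≟A_ y xs * multiplicity _≟L_ ys tails
  ≡⟨ cong (multiplicity _≟A_ y xs *_) (multiplicity-listsOf _≟A_ ys xs) ⟩
    multiplicity _≟A_ y xs * product (map (λ x → multiplicity _≟A_ x xs) ys) ∎
  where
  open ≡-Reasoning
  _≟L_ : DecidableEquality (List A)
  _≟L_ = Listₚ.≡-dec _≟A_
  tails : List (List A)
  tails = listsOf (length ys) xs
  is : List A → ℕ
  is w = 𝟙[ ⌊ w ≟L (y ∷ ys) ⌋ ]

_≟P_ : DecidableEquality Pair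
_≟P_ = ≡-dec _≟_ _≟_

-- The alphabet of the candidate words in ipps.
pairAlphabet : ℕ → ℕ → List Pair
pairAlphabet a b = concatMap (λ x → map (λ y → (x , y)) (upTo (suc b))) (map suc (upTo a))

multiplicity-pairAlphabet : (a b x y : ℕ) → 1 ≤ x → x ≤ a → y ≤ b → multiplicity _≟P_ (x , y) (pairAlphabet a b) ≡ 1
multiplicity-pairAlphabet a b (suc x) y _ x≤a y≤b = begin
    multiplicity _≟P_ (suc x , y) (pairAlphabet a b)
  ≡⟨ sum-map-concatMap is (λ x′ → map (λ y′ → (x′ , y′)) (upTo (suc b))) (map suc (upTo a)) ⟩
    sum (map (λ x′ → sum (map is (map (λ y′ → (x′ , y′)) (upTo (suc b))))) (map suc (upTo a)))
  ≡⟨ sum-map-cong (map suc (upTo a)) (λ x′ → sum-map-map is (λ y′ → (x′ , y′)) (upTo (suc b))) ⟩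
    sum (map (λ x′ → sum (map (λ y′ → is (x′ , y′)) (upTo (suc b)))) (map suc (upTo a)))
  ≡⟨ sum-map-cong (map suc (upTo a)) (λ x′ → sum-map-cong (upTo (suc b)) (λ y′ →
       𝟙-⇔× ((x′ , y′) ≟P (suc x , y)) (x′ ≟ suc x) (y′ ≟ y) (λ { refl → refl , refl }) (λ { refl refl → refl }))) ⟩
    sum (map (λ x′ → sum (map (λ y′ → 𝟙[ ⌊ x′ ≟ suc x ⌋ ] * 𝟙[ ⌊ y′ ≟ y ⌋ ]) (upTo (suc b)))) (map suc (upTo a)))
  ≡⟨ sum-map-cong (map suc (upTo a)) (λ x′ → sum-map-*ˡ 𝟙[ ⌊ x′ ≟ suc x ⌋ ] (λ y′ → 𝟙[ ⌊ y′ ≟ y ⌋ ]) (upTo (suc b))) ⟩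
    sum (map (λ x′ → 𝟙[ ⌊ x′ ≟ suc x ⌋ ] * multiplicity _≟_ y (upTo (suc b))) (map suc (upTo a)))
  ≡⟨ sum-map-*ʳ (multiplicity _≟_ y (upTo (suc b))) (λ x′ → 𝟙[ ⌊ x′ ≟ suc x ⌋ ]) (map suc (upTo a)) ⟩
    multiplicity _≟_ (suc x) (map suc (upTo a)) * multiplicity _≟_ y (upTo (suc b))
  ≡⟨ cong₂ _*_ (multiplicity-unique _≟_ (map suc (upTo a)) (Unique.map⁺ suc-injective (upTo⁺ a)) (∈-map⁺ suc (∈-upTo⁺ x≤a)))
               (multiplicity-unique _≟_ (upTo (suc b)) (upTo⁺ (suc b)) (∈-upTo⁺ (s≤s y≤b))) ⟩
    1 ∎
  where
  open ≡-Reasoning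
  is : Pair → ℕ
  is p = 𝟙[ ⌊ p ≟P (suc x , y) ⌋ ]

length≤sum : (τ : List Pair) → All (λ p → 1 ≤ proj₁ p) τ → length τ ≤ sum (map proj₁ τ)
length≤sum []      []       = z≤n
length≤sum (_ ∷ τ) (p ∷ ps) = +-mono-≤ p (length≤sum τ ps)

multiplicity-ipps : (a b : ℕ) (τ : List Pair) → IsIPP a b τ → multiplicity (Listₚ.≡-dec _≟P_) τ (ipps a b) ≡ 1
multiplicity-ipps a b τ ipp@(parts≥1 , Σa , Σb≤ , _) = begin
    multiplicity _≟L_ τ (ipps a b)
  ≡⟨ multiplicity-filter _≟L_ (isIPP? a b) ipp candidates ⟩
    multiplicity _≟L_ τ candidates
  ≡⟨ sum-map-concatMap (λ w → 𝟙[ ⌊ w ≟L τ ⌋ ]) words (upTo (suc a)) ⟩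
    sum (map (λ L → multiplicity _≟L_ τ (words L)) (upTo (suc a)))
  ≡⟨ sum-map-supported-at _≟_ (length τ) (λ L → multiplicity _≟L_ τ (words L)) (upTo (suc a))
       (λ L _ L≢ → multiplicity-∉ _≟L_ (words L) (λ τ∈ → L≢ (sym (listsOf-length L _ τ∈)))) ⟩
    multiplicity _≟_ (length τ) (upTo (suc a)) * multiplicity _≟L_ τ (words (length τ))
  ≡⟨ cong₂ _*_ (multiplicity-unique _≟_ (upTo (suc a)) (upTo⁺ (suc a))
                  (∈-upTo⁺ (s≤s (≤-trans (length≤sum τ parts≥1) (≤-reflexive Σa)))))
               (multiplicity-listsOf _≟P_ τ (pairAlphabet a b)) ⟩
    1 * product (map (λ p → multiplicity _≟P_ p (pairAlphabet a b)) τ)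
  ≡⟨ cong (1 *_) (product-map-1 _ τ (λ { (x , y) p∈ → multiplicity-pairAlphabet a b x y (All.lookup parts≥1 p∈)
       (≤-trans (∈⇒≤-sum-map proj₁ τ p∈) (≤-reflexive Σa)) (≤-trans (∈⇒≤-sum-map proj₂ τ p∈) Σb≤) })) ⟩
    1 ∎
  where
  open ≡-Reasoning
  _≟L_ : DecidableEquality (List Pair)
  _≟L_ = Listₚ.≡-dec _≟P_
  words : ℕ → List (List Pair)
  words L = listsOf L (pairAlphabet a b)
  candidates : List (List Pair)
  candidates = concatMap words (upTo (suc a))

multiplicity-upTo : (k x : ℕ) → x < k → sum (map (λ b → 𝟙[ ⌊ x ≟ b ⌋ ]) (upTo k)) ≡ 1
multiplicity-upTo k x x<k = trans (sum-map-cong (upTo k) (λ b → cong 𝟙[_] (⌊⌋-cong-⇔ (x ≟ b) (b ≟ x) sym sym)))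
  (multiplicity-unique _≟_ (upTo k) (upTo⁺ k) (∈-upTo⁺ x<k))

∈-ipps⇒IsIPP : (a b : ℕ) {τ : List Pair} → τ ∈ ipps a b → IsIPP a b τ
∈-ipps⇒IsIPP a b τ∈ = proj₂ (∈-filter⁻ (isIPP? a b) {xs = concatMap (λ L → listsOf L (pairAlphabet a b)) (upTo (suc a))} τ∈)

-- The lexicographic order on pairs, and sorting

≥lex-trans : {p q r : Pair} → p ≥lex q → q ≥lex r → p ≥lex r
≥lex-trans (inj₁ q<p)           (inj₁ r<q)          = inj₁ (<-trans r<q q<p)
≥lex-trans (inj₁ q<p)           (inj₂ (refl , _))   = inj₁ q<p
≥lex-trans (inj₂ (refl , _))    (inj₁ r<q)          = inj₁ r<q
≥lex-trans (inj₂ (refl , q≤p))  (inj₂ (refl , r≤q)) = inj₂ (refl , ≤-trans r≤q q≤p)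

≥lex-antisym : {p q : Pair} → p ≥lex q → q ≥lex p → p ≡ q
≥lex-antisym (inj₁ q<p)          (inj₁ p<q)          = ⊥-elim (<-asym q<p p<q)
≥lex-antisym (inj₁ q<p)          (inj₂ (refl , _))   = ⊥-elim (<-irrefl refl q<p)
≥lex-antisym (inj₂ (refl , _))   (inj₁ p<q)          = ⊥-elim (<-irrefl refl p<q)
≥lex-antisym (inj₂ (refl , q≤p)) (inj₂ (_ , p≤q))    = cong (_ ,_) (≤-antisym p≤q q≤p)

≥lex-total : (p q : Pair) → p ≥lex q ⊎ q ≥lex p
≥lex-total (a , b) (a′ , b′) with <-cmp a a′
... | tri< a<a′ _ _ = inj₂ (inj₁ a<a′)
... | tri> _ _ a′<a = inj₁ (inj₁ a′<a)
... | tri≈ _ refl _ with ≤-total b′ b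
...   | inj₁ b′≤b = inj₁ (inj₂ (refl , b′≤b))
...   | inj₂ b≤b′ = inj₂ (inj₂ (refl , b≤b′))

≥lex-isDecTotalOrder : IsDecTotalOrder _≡_ _≥lex_
≥lex-isDecTotalOrder = record
  { isTotalOrder = record
    { isPartialOrder = record
      { isPreorder = record
        { isEquivalence = isEquivalence
        ; reflexive     = λ { {a , b} refl → inj₂ (refl , ≤-refl) }
        ; trans         = ≥lex-trans
        }
      ; antisym = ≥lex-antisym
      }
    ; total = ≥lex-total
    }
  ; _≟_  = _≟P_
  ; _≤?_ = _≥lex?_
  }

≥lex-decTotalOrder : DecTotalOrder 0ℓ 0ℓ 0ℓ
≥lex-decTotalOrder = record { isDecTotalOrder = ≥lex-isDecTotalOrder }

open import Data.List.Sort ≥lex-decTotalOrder using (sort; sort-↭; sort-↗)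

sorted-↭⇒≡ : {τ τ′ : List Pair} → Linked _≥lex_ τ → Linked _≥lex_ τ′ → τ ↭ τ′ → τ ≡ τ′
sorted-↭⇒≡ τ↘ τ′↘ τ↭τ′ =
  Pointwise-≡⇒≡ (↗↭↗⇒≋ (DecTotalOrder.totalOrder ≥lex-decTotalOrder) τ↘ τ′↘ (↭⇒↭ₛ τ↭τ′))

removeOne-just⇒↭ : (p : Pair) (qs : List Pair) {qs′ : List Pair} → removeOne p qs ≡ just qs′ → qs ↭ p ∷ qs′
removeOne-just⇒↭ p (q ∷ qs) e with ≡-dec _≟_ _≟_ p q
removeOne-just⇒↭ p (q ∷ qs) refl | yes refl = ↭-refl
... | no _ with removeOne p qs in eq
removeOne-just⇒↭ p (q ∷ qs) refl | no _ | just qs′ = ↭-trans (↭-prep q (removeOne-just⇒↭ p qs eq)) (↭-swap q p ↭-refl)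

∈⇒removeOne-just : (p : Pair) (qs : List Pair) → p ∈ qs → ∃ λ qs′ → removeOne p qs ≡ just qs′
∈⇒removeOne-just p (q ∷ qs) p∈ with ≡-dec _≟_ _≟_ p q
... | yes _ = qs , refl
∈⇒removeOne-just p (q ∷ qs) (here p≡q) | no p≢q = ⊥-elim (p≢q p≡q)
∈⇒removeOne-just p (q ∷ qs) (there p∈) | no _ with ∈⇒removeOne-just p qs p∈
... | qs′ , e rewrite e = q ∷ qs′ , refl

sameMonomial⇒↭ : (ps qs : List Pair) → sameMonomial ps qs ≡ true → ps ↭ qs
sameMonomial⇒↭ []       []  e = ↭-refl
sameMonomial⇒↭ (p ∷ ps) qs e with removeOne p qs in eq
sameMonomial⇒↭ (p ∷ ps) qs e | just qs′ =
  ↭-trans (↭-prep p (sameMonomial⇒↭ ps qs′ e)) (↭-sym (removeOne-just⇒↭ p qs eq))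

↭⇒sameMonomial : (ps qs : List Pair) → ps ↭ qs → sameMonomial ps qs ≡ true
↭⇒sameMonomial []       []      ps↭qs = refl
↭⇒sameMonomial []       (_ ∷ _) ps↭qs with () ← ↭-length ps↭qs
↭⇒sameMonomial (p ∷ ps) qs      ps↭qs with removeOne p qs in eq
... | just qs′ = ↭⇒sameMonomial ps qs′ (drop-∷ (↭-trans ps↭qs (removeOne-just⇒↭ p qs eq)))
... | nothing with qs′ , e ← ∈⇒removeOne-just p qs (∈-resp-↭ ps↭qs (here refl)) with () ← trans (sym eq) e

-- Restricted growth strings

rgs-< : {x k : ℕ} (xs : List ℕ) → x < k → rgs k (x ∷ xs) ≡ rgs k xs
rgs-< {x} {k} xs x<k with x <? k | x ≟ k
... | yes _  | _ = refl
... | no x≮k | _ = ⊥-elim (x≮k x<k)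

rgs-≡ : {k : ℕ} (xs : List ℕ) → rgs k (k ∷ xs) ≡ rgs (suc k) xs
rgs-≡ {k} xs with k <? k | k ≟ k
... | yes k<k | _      = ⊥-elim (n≮n k k<k)
... | no _    | yes _  = refl
... | no _    | no k≢k = ⊥-elim (k≢k refl)

rgs-> : {x k : ℕ} (xs : List ℕ) → k < x → rgs k (x ∷ xs) ≡ nothing
rgs-> {x} {k} xs k<x with x <? k | x ≟ k
... | yes x<k | _      = ⊥-elim (<-asym k<x x<k)
... | no _    | yes refl = ⊥-elim (n≮n x k<x)
... | no _    | no _   = refl

rgs-mono : (k : ℕ) (xs : List ℕ) {k′ : ℕ} → rgs k xs ≡ just k′ → k ≤ k′
rgs-mono k []       refl = ≤-refl
rgs-mono k (x ∷ xs) e with x <? k | x ≟ k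
... | yes _ | _     = rgs-mono k xs e
... | no _  | yes _ = ≤-trans (n≤1+n k) (rgs-mono (suc k) xs e)
rgs-mono k (x ∷ xs) () | no _ | no _

rgs-bounded : (k : ℕ) (xs : List ℕ) {k′ : ℕ} → rgs k xs ≡ just k′ → All (_< k′) xs
rgs-bounded k []       e = []
rgs-bounded k (x ∷ xs) e with x <? k | x ≟ k
... | yes x<k | _        = <-≤-trans x<k (rgs-mono k xs e) ∷ rgs-bounded k xs e
... | no _    | yes refl = rgs-mono (suc x) xs e ∷ rgs-bounded (suc k) xs e
rgs-bounded k (x ∷ xs) () | no _ | no _

rgs-surjective : (k : ℕ) (xs : List ℕ) {k′ : ℕ} → rgs k xs ≡ just k′ → ∀ j → k ≤ j → j < k′ → j ∈ xs
rgs-surjective k []       refl j k≤j j<k = ⊥-elim (<-irrefl refl (≤-<-trans k≤j j<k))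
rgs-surjective k (x ∷ xs) e j k≤j j<k′ with x <? k | x ≟ k
... | yes _ | _ = there (rgs-surjective k xs e j k≤j j<k′)
... | no _  | yes refl with j ≟ x
...   | yes refl = here refl
...   | no j≢x   = there (rgs-surjective (suc k) xs e j (≤∧≢⇒< k≤j (λ x≡j → j≢x (sym x≡j))) j<k′)
rgs-surjective k (x ∷ xs) () j k≤j j<k′ | no _ | no _

labels : {n ℓ : ℕ} → Vec (Fin n) ℓ → List ℕ
labels s = map toℕ (toList s)

∈-labels⁻ : {n ℓ : ℕ} (r : Vec (Fin n) ℓ) {x : ℕ} → x ∈ labels r → ∃ λ v → toℕ (Vec.lookup r v) ≡ x
∈-labels⁻ (y ∷ r) (here refl) = zero , refl
∈-labels⁻ (y ∷ r) (there x∈) with v , e ← ∈-labels⁻ r x∈ = suc v , e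

lookupMaybe : List A → ℕ → Maybe A
lookupMaybe []       _       = nothing
lookupMaybe (x ∷ xs) zero    = just x
lookupMaybe (x ∷ xs) (suc j) = lookupMaybe xs j

lookupMaybe-++ˡ : (c d : List A) (j : ℕ) → j < length c → lookupMaybe (c ++ d) j ≡ lookupMaybe c j
lookupMaybe-++ˡ (x ∷ c) d zero    _         = refl
lookupMaybe-++ˡ (x ∷ c) d (suc j) (s≤s j<c) = lookupMaybe-++ˡ c d j j<c

lookupMaybe-length : (c d : List A) (i : A) → lookupMaybe (c ++ i ∷ d) (length c) ≡ just i
lookupMaybe-length []      d i = refl
lookupMaybe-length (x ∷ c) d i = lookupMaybe-length c d i

lookupMaybe-< : (c : List A) (j : ℕ) → j < length c → ∃ λ y → lookupMaybe c j ≡ just y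
lookupMaybe-< (x ∷ c) zero    _         = x , refl
lookupMaybe-< (x ∷ c) (suc j) (s≤s j<c) = lookupMaybe-< c j j<c

lookupMaybe-just⇒< : (c : List A) (j : ℕ) {y : A} → lookupMaybe c j ≡ just y → j < length c
lookupMaybe-just⇒< (x ∷ c) zero    _ = s≤s z≤n
lookupMaybe-just⇒< (x ∷ c) (suc j) e = s≤s (lookupMaybe-just⇒< c j e)

lookupMaybe-∈ : (c : List A) (j : ℕ) {y : A} → lookupMaybe c j ≡ just y → y ∈ c
lookupMaybe-∈ (x ∷ c) zero    refl = here refl
lookupMaybe-∈ (x ∷ c) (suc j) e    = there (lookupMaybe-∈ c j e)

lookupMaybe-injective : (c : List A) → Unique c → (i j : ℕ) {y : A} →
  lookupMaybe c i ≡ just y → lookupMaybe c j ≡ just y → i ≡ j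
lookupMaybe-injective (x ∷ c) u         zero    zero    _    _    = refl
lookupMaybe-injective (x ∷ c) u         zero    (suc j) refl e    = ⊥-elim (Unique[x∷xs]⇒x∉xs u (lookupMaybe-∈ c j e))
lookupMaybe-injective (x ∷ c) u         (suc i) zero    e    refl = ⊥-elim (Unique[x∷xs]⇒x∉xs u (lookupMaybe-∈ c i e))
lookupMaybe-injective (x ∷ c) (_ ∷ u)   (suc i) (suc j) e₁   e₂   = cong suc (lookupMaybe-injective c u i j e₁ e₂)

length-∷ʳ : (c : List A) (i : A) → length (c ++ i ∷ []) ≡ suc (length c)
length-∷ʳ c i = trans (length-++ c) (+-comm (length c) 1)

Unique-++⁻ˡ : (c d : List A) → Unique (c ++ d) → Unique c
Unique-++⁻ˡ []      d u       = []
Unique-++⁻ˡ (x ∷ c) d (x∉ ∷ u) = Allₚ.++⁻ˡ c x∉ ∷ Unique-++⁻ˡ c d u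

Unique-∷ʳ⁺ : (c : List A) (i : A) → Unique c → i ∉ c → Unique (c ++ i ∷ [])
Unique-∷ʳ⁺ c i u i∉c = Unique.++⁺ u ([] ∷ []) (λ { (i∈c , here refl) → i∉c i∈c })

Unique-∷ʳ⁻ : (c : List A) (i : A) → Unique (c ++ i ∷ []) → i ∉ c
Unique-∷ʳ⁻ (x ∷ c) i (x∉ ∷ u) (here refl) with x≢i ∷ [] ← Allₚ.++⁻ʳ c x∉ = x≢i refl
Unique-∷ʳ⁻ (x ∷ c) i (_ ∷ u)  (there i∈c) = Unique-∷ʳ⁻ c i u i∈c

-- Colourings as set partitions with distinctly coloured blocks

m∸n≡suc[m∸suc[n]] : (n m : ℕ) → suc n ≤ m → m ∸ n ≡ suc (m ∸ suc n)
m∸n≡suc[m∸suc[n]] zero    (suc m) _         = refl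
m∸n≡suc[m∸suc[n]] (suc n) (suc m) (s≤s n<m) = m∸n≡suc[m∸suc[n]] n m n<m

sum-allFin-byPosition : {B : Set} (n : ℕ) (c : List B) (g : B → ℕ) (h : ℕ) (f : Fin n → ℕ) → length c < n →
  (∀ x y → lookupMaybe c (toℕ x) ≡ just y → f x ≡ g y) →
  (∀ x → toℕ x ≡ length c → f x ≡ h) →
  (∀ x → length c < toℕ x → f x ≡ 0) →
  sum (map f (allFin n)) ≡ sum (map g c) + h
sum-allFin-byPosition (suc n) []      g h f _ old new gap = begin
    sum (map f (allFin (suc n)))
  ≡⟨ sum-map-allFin-suc n f ⟩
    f zero + sum (map (f ∘ suc) (allFin n))
  ≡⟨ cong₂ _+_ (new zero refl) (sum-map-zero (allFin n) (λ x _ → gap (suc x) (s≤s z≤n))) ⟩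
    h + 0
  ≡⟨ +-identityʳ h ⟩
    h ∎
  where open ≡-Reasoning
sum-allFin-byPosition (suc n) (y ∷ c) g h f (s≤s c<n) old new gap = begin
    sum (map f (allFin (suc n)))
  ≡⟨ sum-map-allFin-suc n f ⟩
    f zero + sum (map (f ∘ suc) (allFin n))
  ≡⟨ cong₂ _+_ (old zero y refl) (sum-allFin-byPosition n c g h (f ∘ suc) c<n
       (λ x → old (suc x)) (λ x e → new (suc x) (cong suc e)) (λ x c<x → gap (suc x) (s≤s c<x))) ⟩
    g y + (sum (map g c) + h)
  ≡⟨ sym (+-assoc (g y) _ h) ⟩
    g y + sum (map g c) + h ∎
  where open ≡-Reasoning

distinct : {N : ℕ} → List (Fin N) → Bool
distinct cs = ⌊ UniqueDec.unique? _≟F_ cs ⌋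

module BlockColourings (n N : ℕ) where

  open import Data.List.Membership.DecPropositional (_≟F_ {N}) using (_∈?_)

  sum-allFin-∈? : (G : Fin N → ℕ) (c : List (Fin N)) → Unique c →
    sum (map (λ i → if ⌊ i ∈? c ⌋ then G i else 0) (allFin N)) ≡ sum (map G c)
  sum-allFin-∈? G []      _                = sum-map-zero (allFin N) (λ _ _ → refl)
  sum-allFin-∈? G (y ∷ c) u@(_ ∷ u′) = begin
      sum (map (λ i → if ⌊ i ∈? y ∷ c ⌋ then G i else 0) (allFin N))
    ≡⟨ sum-map-cong (allFin N) split ⟩
      sum (map (λ i → 𝟙[ ⌊ i ≟F y ⌋ ] * G i + (if ⌊ i ∈? c ⌋ then G i else 0)) (allFin N))
    ≡⟨ sum-map-+ (λ i → 𝟙[ ⌊ i ≟F y ⌋ ] * G i) (λ i → if ⌊ i ∈? c ⌋ then G i else 0) (allFin N) ⟩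
      sum (map (λ i → 𝟙[ ⌊ i ≟F y ⌋ ] * G i) (allFin N)) + sum (map (λ i → if ⌊ i ∈? c ⌋ then G i else 0) (allFin N))
    ≡⟨ cong₂ _+_ atY (sum-allFin-∈? G c u′) ⟩
      G y + sum (map G c) ∎
    where
    open ≡-Reasoning
    y∉c : y ∉ c
    y∉c = Unique[x∷xs]⇒x∉xs u
    split : ∀ i → (if ⌊ i ∈? y ∷ c ⌋ then G i else 0) ≡ 𝟙[ ⌊ i ≟F y ⌋ ] * G i + (if ⌊ i ∈? c ⌋ then G i else 0)
    split i with i ∈? (y ∷ c) | i ≟F y | i ∈? c
    ... | yes _         | yes refl | yes y∈c = ⊥-elim (y∉c y∈c)
    ... | yes _         | yes refl | no _    = sym (trans (+-identityʳ _) (+-identityʳ (G i)))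
    ... | yes _         | no _     | yes _   = refl
    ... | yes (here e)  | no i≢y   | no _    = ⊥-elim (i≢y e)
    ... | yes (there p) | no _     | no i∉c  = ⊥-elim (i∉c p)
    ... | no i∉         | yes refl | _       = ⊥-elim (i∉ (here refl))
    ... | no i∉         | no _     | yes p   = ⊥-elim (i∉ (there p))
    ... | no _          | no _     | no _    = refl
    atY : sum (map (λ i → 𝟙[ ⌊ i ≟F y ⌋ ] * G i) (allFin N)) ≡ G y
    atY = begin
        sum (map (λ i → 𝟙[ ⌊ i ≟F y ⌋ ] * G i) (allFin N))
      ≡⟨ sum-map-supported-at _≟F_ y _ (allFin N) (λ x _ x≢y → cong (_* G x) (𝟙-no (x ≟F y) x≢y)) ⟩
        multiplicity _≟F_ y (allFin N) * (𝟙[ ⌊ y ≟F y ⌋ ] * G y)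
      ≡⟨ cong₂ _*_ (multiplicity-allFin N y) (cong (_* G y) (𝟙-yes (y ≟F y) refl)) ⟩
        1 * (1 * G y)
      ≡⟨ trans (*-identityˡ _) (*-identityˡ _) ⟩
        G y ∎

  sum-allFin-split-∈ : (G : Fin N → ℕ) (c : List (Fin N)) → Unique c →
    sum (map G (allFin N)) ≡ sum (map G c) + sum (map (λ i → if ⌊ i ∈? c ⌋ then 0 else G i) (allFin N))
  sum-allFin-split-∈ G c u = begin
      sum (map G (allFin N))
    ≡⟨ sum-map-cong (allFin N) split ⟩
      sum (map (λ i → (if ⌊ i ∈? c ⌋ then G i else 0) + (if ⌊ i ∈? c ⌋ then 0 else G i)) (allFin N))
    ≡⟨ sum-map-+ (λ i → if ⌊ i ∈? c ⌋ then G i else 0) (λ i → if ⌊ i ∈? c ⌋ then 0 else G i) (allFin N) ⟩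
      sum (map (λ i → if ⌊ i ∈? c ⌋ then G i else 0) (allFin N)) + sum (map (λ i → if ⌊ i ∈? c ⌋ then 0 else G i) (allFin N))
    ≡⟨ cong (_+ sum (map (λ i → if ⌊ i ∈? c ⌋ then 0 else G i) (allFin N))) (sum-allFin-∈? G c u) ⟩
      sum (map G c) + sum (map (λ i → if ⌊ i ∈? c ⌋ then 0 else G i) (allFin N)) ∎
    where
    open ≡-Reasoning
    split : ∀ i → G i ≡ (if ⌊ i ∈? c ⌋ then G i else 0) + (if ⌊ i ∈? c ⌋ then 0 else G i)
    split i with ⌊ i ∈? c ⌋
    ... | true  = sym (+-identityʳ (G i))
    ... | false = refl

  distinct-++-¬Unique : (c d : List (Fin N)) → ¬ Unique c → distinct (c ++ d) ≡ false
  distinct-++-¬Unique c d ¬u with UniqueDec.unique? _≟F_ (c ++ d)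
  ... | yes u = ⊥-elim (¬u (Unique-++⁻ˡ c d u))
  ... | no _  = refl

  distinct-Unique : (c : List (Fin N)) → Unique c → distinct c ≡ true
  distinct-Unique c u with UniqueDec.unique? _≟F_ c
  ... | yes _ = refl
  ... | no ¬u = ⊥-elim (¬u u)

  colouring : {ℓ : ℕ} → List (Fin N) → Vec (Fin n) ℓ → Maybe (Vec (Fin N) ℓ)
  colouring cs []      = just []
  colouring cs (x ∷ s) = Maybe.zipWith _∷_ (lookupMaybe cs (toℕ x)) (colouring cs s)

  maybe′-zipWith-∷ : {ℓ : ℕ} (Φ : Vec (Fin N) (suc ℓ) → ℕ) (y : Fin N) (m : Maybe (Vec (Fin N) ℓ)) →
    maybe′ Φ 0 (Maybe.zipWith _∷_ (just y) m) ≡ maybe′ (Φ ∘ (y ∷_)) 0 m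
  maybe′-zipWith-∷ Φ y nothing  = refl
  maybe′-zipWith-∷ Φ y (just v) = refl

  colouring-just : {ℓ : ℕ} (l : List (Fin N)) (r : Vec (Fin n) ℓ) → (∀ v → toℕ (Vec.lookup r v) < length l) →
    ∃ λ χ → colouring l r ≡ just χ × (∀ v → lookupMaybe l (toℕ (Vec.lookup r v)) ≡ just (Vec.lookup χ v))
  colouring-just l []      _ = [] , refl , λ ()
  colouring-just l (x ∷ r) bounded
    with y , e ← lookupMaybe-< l (toℕ x) (bounded zero) | χ , e′ , χ-spec ← colouring-just l r (bounded ∘ suc)
    rewrite e | e′ = y ∷ χ , refl , λ { zero → e ; (suc v) → χ-spec v }

  extensionTerm : {ℓ : ℕ} → List (Fin N) → Vec (Fin n) ℓ → (Vec (Fin N) ℓ → ℕ) → List (Fin N) → ℕ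
  extensionTerm c s Φ d = if distinct (c ++ d) then maybe′ Φ 0 (colouring (c ++ d) s) else 0

  extensionSum : {ℓ : ℕ} → List (Fin N) → Vec (Fin n) ℓ → (Vec (Fin N) ℓ → ℕ) → Maybe ℕ → ℕ
  extensionSum c s Φ nothing  = 0
  extensionSum c s Φ (just k) = sum (map (λ d → extensionTerm c s Φ (toList d)) (vecs N (k ∸ length c)))

  -- The first length c blocks are already coloured by c; the labels s continue a restricted growth string.
  blockColouringSum : {ℓ : ℕ} → List (Fin N) → Vec (Fin n) ℓ → (Vec (Fin N) ℓ → ℕ) → ℕ
  blockColouringSum c s Φ = extensionSum c s Φ (rgs (length c) (labels s))

  extensionSum-¬Unique : {ℓ : ℕ} (c : List (Fin N)) (s : Vec (Fin n) ℓ) (Φ : Vec (Fin N) ℓ → ℕ) (r : Maybe ℕ) →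
    ¬ Unique c → extensionSum c s Φ r ≡ 0
  extensionSum-¬Unique c s Φ nothing  ¬u = refl
  extensionSum-¬Unique c s Φ (just k) ¬u = sum-map-zero (vecs N (k ∸ length c)) (λ d _ →
    cong (λ b → if b then maybe′ Φ 0 (colouring (c ++ toList d) s) else 0) (distinct-++-¬Unique c (toList d) ¬u))

  blockColouringSum-[] : (c : List (Fin N)) → Unique c → (Φ : Vec (Fin N) 0 → ℕ) → blockColouringSum c [] Φ ≡ Φ []
  blockColouringSum-[] c u Φ = begin
      sum (map (λ d → extensionTerm c [] Φ (toList d)) (vecs N (length c ∸ length c)))
    ≡⟨ cong (λ j → sum (map (λ d → extensionTerm c [] Φ (toList d)) (vecs N j))) (n∸n≡0 (length c)) ⟩
      extensionTerm c [] Φ [] + 0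
    ≡⟨ +-identityʳ _ ⟩
      (if distinct (c ++ []) then Φ [] else 0)
    ≡⟨ cong (λ b → if b then Φ [] else 0) (trans (cong distinct (++-identityʳ c)) (distinct-Unique c u)) ⟩
      Φ [] ∎
    where open ≡-Reasoning

  blockColouringSum-old : {ℓ : ℕ} (c : List (Fin N)) (x : Fin n) (s : Vec (Fin n) ℓ) (Φ : Vec (Fin N) (suc ℓ) → ℕ)
    (y : Fin N) → lookupMaybe c (toℕ x) ≡ just y → blockColouringSum c (x ∷ s) Φ ≡ blockColouringSum c s (Φ ∘ (y ∷_))
  blockColouringSum-old c x s Φ y e =
    trans (cong (extensionSum c (x ∷ s) Φ) (rgs-< (labels s) x<c)) (sameTerms (rgs (length c) (labels s)))
    where
    x<c : toℕ x < length c
    x<c = lookupMaybe-just⇒< c (toℕ x) e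
    sameTerm : (d : List (Fin N)) → extensionTerm c (x ∷ s) Φ d ≡ extensionTerm c s (Φ ∘ (y ∷_)) d
    sameTerm d rewrite lookupMaybe-++ˡ c d (toℕ x) x<c | e =
      cong (λ z → if distinct (c ++ d) then z else 0) (maybe′-zipWith-∷ Φ y (colouring (c ++ d) s))
    sameTerms : (r : Maybe ℕ) → extensionSum c (x ∷ s) Φ r ≡ extensionSum c s (Φ ∘ (y ∷_)) r
    sameTerms nothing  = refl
    sameTerms (just k) = sum-map-cong (vecs N (k ∸ length c)) (λ d → sameTerm (toList d))

  extensionSum-new : {ℓ : ℕ} (c : List (Fin N)) (x : Fin n) (s : Vec (Fin n) ℓ) (Φ : Vec (Fin N) (suc ℓ) → ℕ) →
    toℕ x ≡ length c → (r : Maybe ℕ) → (∀ k → r ≡ just k → suc (length c) ≤ k) →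
    extensionSum c (x ∷ s) Φ r ≡ sum (map (λ i → extensionSum (c ++ i ∷ []) s (Φ ∘ (i ∷_)) r) (allFin N))
  extensionSum-new c x s Φ x≡c nothing  _      = sym (sum-map-zero (allFin N) (λ _ _ → refl))
  extensionSum-new c x s Φ x≡c (just k) c<k = begin
      sum (map (λ d → extensionTerm c (x ∷ s) Φ (toList d)) (vecs N (k ∸ length c)))
    ≡⟨ cong (λ j → sum (map (λ d → extensionTerm c (x ∷ s) Φ (toList d)) (vecs N j)))
            (m∸n≡suc[m∸suc[n]] (length c) k (c<k k refl)) ⟩
      sum (map (λ d → extensionTerm c (x ∷ s) Φ (toList d)) (vecs N (suc rest)))
    ≡⟨ sum-map-vecs-suc N rest (λ d → extensionTerm c (x ∷ s) Φ (toList d)) ⟩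
      sum (map (λ i → sum (map (λ d → extensionTerm c (x ∷ s) Φ (i ∷ toList d)) (vecs N rest))) (allFin N))
    ≡⟨ sum-map-cong (allFin N) (λ i → sum-map-cong (vecs N rest) (λ d → sameTerm i (toList d))) ⟩
      sum (map (λ i → sum (map (λ d → extensionTerm (c ++ i ∷ []) s (Φ ∘ (i ∷_)) (toList d)) (vecs N rest))) (allFin N))
    ≡⟨ sum-map-cong (allFin N) (λ i →
         cong (λ j → sum (map (λ d → extensionTerm (c ++ i ∷ []) s (Φ ∘ (i ∷_)) (toList d)) (vecs N (k ∸ j))))
              (sym (length-∷ʳ c i))) ⟩
      sum (map (λ i → extensionSum (c ++ i ∷ []) s (Φ ∘ (i ∷_)) (just k)) (allFin N)) ∎
    where
    open ≡-Reasoning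
    rest : ℕ
    rest = k ∸ suc (length c)
    sameTerm : (i : Fin N) (d : List (Fin N)) → extensionTerm c (x ∷ s) Φ (i ∷ d) ≡ extensionTerm (c ++ i ∷ []) s (Φ ∘ (i ∷_)) d
    sameTerm i d rewrite ++-assoc c (i ∷ []) d | x≡c | lookupMaybe-length c d i =
      cong (λ z → if distinct (c ++ i ∷ d) then z else 0) (maybe′-zipWith-∷ Φ i (colouring (c ++ i ∷ d) s))

  -- A colouring of a vertex sequence is the same as the restricted growth string of its colour classes
  -- together with distinct colours for the blocks; peeling off one vertex at a time, with c the colours
  -- of the blocks met so far, proves this bijection at the level of sums.
  Decomposes : ℕ → Set
  Decomposes ℓ = (c : List (Fin N)) → Unique c → length c + ℓ ≤ n → (Φ : Vec (Fin N) ℓ → ℕ) →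
    sum (map Φ (vecs N ℓ)) ≡ sum (map (λ s → blockColouringSum c s Φ) (vecs n ℓ))

  module DecompositionStep {ℓ : ℕ} (decomposes : Decomposes ℓ) (c : List (Fin N)) (u : Unique c)
                           (Φ : Vec (Fin N) (suc ℓ) → ℕ) where

    firstColour : Fin N → ℕ
    firstColour i = sum (map (λ v → Φ (i ∷ v)) (vecs N ℓ))

    freshColours : ℕ
    freshColours = sum (map (λ i → if ⌊ i ∈? c ⌋ then 0 else firstColour i) (allFin N))

    firstLabel : Fin n → ℕ
    firstLabel x = sum (map (λ s → blockColouringSum c (x ∷ s) Φ) (vecs n ℓ))

    firstLabel-old : length c + ℓ ≤ n → (x : Fin n) (y : Fin N) → lookupMaybe c (toℕ x) ≡ just y →
      firstLabel x ≡ firstColour y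
    firstLabel-old c+ℓ≤n x y e = trans (sum-map-cong (vecs n ℓ) (λ s → blockColouringSum-old c x s Φ y e))
                                       (sym (decomposes c u c+ℓ≤n (Φ ∘ (y ∷_))))

    firstLabel-new : suc (length c) + ℓ ≤ n → (x : Fin n) → toℕ x ≡ length c → firstLabel x ≡ freshColours
    firstLabel-new c+1+ℓ≤n x x≡c = begin
        sum (map (λ s → blockColouringSum c (x ∷ s) Φ) (vecs n ℓ))
      ≡⟨ sum-map-cong (vecs n ℓ) openBlock ⟩
        sum (map (λ s → sum (map (λ i → blockColouringSum (c ++ i ∷ []) s (Φ ∘ (i ∷_))) (allFin N))) (vecs n ℓ))
      ≡⟨ sum-map-swap (λ s i → blockColouringSum (c ++ i ∷ []) s (Φ ∘ (i ∷_))) (vecs n ℓ) (allFin N) ⟩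
        sum (map (λ i → sum (map (λ s → blockColouringSum (c ++ i ∷ []) s (Φ ∘ (i ∷_))) (vecs n ℓ))) (allFin N))
      ≡⟨ sum-map-cong (allFin N) colourBlock ⟩
        freshColours ∎
      where
      open ≡-Reasoning
      openBlock : (s : Vec (Fin n) ℓ) →
        blockColouringSum c (x ∷ s) Φ ≡ sum (map (λ i → blockColouringSum (c ++ i ∷ []) s (Φ ∘ (i ∷_))) (allFin N))
      openBlock s = begin
          extensionSum c (x ∷ s) Φ (rgs (length c) (toℕ x ∷ labels s))
        ≡⟨ cong (λ j → extensionSum c (x ∷ s) Φ (rgs (length c) (j ∷ labels s))) x≡c ⟩
          extensionSum c (x ∷ s) Φ (rgs (length c) (length c ∷ labels s))
        ≡⟨ cong (extensionSum c (x ∷ s) Φ) (rgs-≡ (labels s)) ⟩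
          extensionSum c (x ∷ s) Φ (rgs (suc (length c)) (labels s))
        ≡⟨ extensionSum-new c x s Φ x≡c (rgs (suc (length c)) (labels s)) (λ k e → rgs-mono (suc (length c)) (labels s) e) ⟩
          sum (map (λ i → extensionSum (c ++ i ∷ []) s (Φ ∘ (i ∷_)) (rgs (suc (length c)) (labels s))) (allFin N))
        ≡⟨ sum-map-cong (allFin N) (λ i → cong (λ j → extensionSum (c ++ i ∷ []) s (Φ ∘ (i ∷_)) (rgs j (labels s)))
                                               (sym (length-∷ʳ c i))) ⟩
          sum (map (λ i → blockColouringSum (c ++ i ∷ []) s (Φ ∘ (i ∷_))) (allFin N)) ∎
      colourBlock : (i : Fin N) → sum (map (λ s → blockColouringSum (c ++ i ∷ []) s (Φ ∘ (i ∷_))) (vecs n ℓ)) ≡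
                                  (if ⌊ i ∈? c ⌋ then 0 else firstColour i)
      colourBlock i with i ∈? c
      ... | yes i∈c = sum-map-zero (vecs n ℓ) (λ s _ →
              extensionSum-¬Unique (c ++ i ∷ []) s (Φ ∘ (i ∷_)) (rgs (length (c ++ i ∷ [])) (labels s)) (λ u′ → Unique-∷ʳ⁻ c i u′ i∈c))
      ... | no i∉c  = sym (decomposes (c ++ i ∷ []) (Unique-∷ʳ⁺ c i u i∉c)
              (≤-trans (≤-reflexive (cong (_+ ℓ) (length-∷ʳ c i))) c+1+ℓ≤n) (Φ ∘ (i ∷_)))

    firstLabel-gap : (x : Fin n) → length c < toℕ x → firstLabel x ≡ 0
    firstLabel-gap x c<x = sum-map-zero (vecs n ℓ) (λ s _ → cong (extensionSum c (x ∷ s) Φ) (rgs-> (labels s) c<x))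

  decomposition : (ℓ : ℕ) → Decomposes ℓ
  decomposition zero    c u _ Φ = cong (_+ 0) (sym (blockColouringSum-[] c u Φ))
  decomposition (suc ℓ) c u c+sucℓ≤n Φ = begin
      sum (map Φ (vecs N (suc ℓ)))
    ≡⟨ sum-map-vecs-suc N ℓ Φ ⟩
      sum (map firstColour (allFin N))
    ≡⟨ sum-allFin-split-∈ firstColour c u ⟩
      sum (map firstColour c) + freshColours
    ≡⟨ sum-allFin-byPosition n c firstColour freshColours firstLabel c<n
         (firstLabel-old c+ℓ≤n) (firstLabel-new c+1+ℓ≤n) firstLabel-gap ⟨
      sum (map firstLabel (allFin n))
    ≡⟨ sum-map-vecs-suc n ℓ (λ s → blockColouringSum c s Φ) ⟨
      sum (map (λ s → blockColouringSum c s Φ) (vecs n (suc ℓ))) ∎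
    where
    open ≡-Reasoning
    open DecompositionStep (decomposition ℓ) c u Φ
    c+1+ℓ≤n : suc (length c) + ℓ ≤ n
    c+1+ℓ≤n = ≤-trans (≤-reflexive (sym (+-suc (length c) ℓ))) c+sucℓ≤n
    c+ℓ≤n : length c + ℓ ≤ n
    c+ℓ≤n = ≤-trans (n≤1+n _) c+1+ℓ≤n
    c<n : length c < n
    c<n = ≤-trans (s≤s (m≤m+n (length c) ℓ)) c+1+ℓ≤n

-- The colourings with a given partition and the augmented monomial

zip-mapˡ : {C : Set} (f : A → B) (xs : List A) (ys : List C) →
  zip (map f xs) ys ≡ map (λ q → f (proj₁ q) , proj₂ q) (zip xs ys)
zip-mapˡ f xs ys = trans (cong (zip (map f xs)) (sym (map-id ys))) (zip-map f id xs ys)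

upTo-suc : (k : ℕ) → upTo (suc k) ≡ 0 ∷ map suc (upTo k)
upTo-suc k = cong (0 ∷_) (sym (map-applyUpTo id suc k))

if-sum : (b : Bool) (f : A → ℕ) (xs : List A) →
  (if b then sum (map f xs) else 0) ≡ sum (map (λ x → if b then f x else 0) xs)
if-sum true  f xs = refl
if-sum false f xs = sym (sum-map-zero xs (λ _ _ → refl))

if-𝟙 : (b c : Bool) → (if b then 𝟙[ c ] else 0) ≡ 𝟙[ c ] * 𝟙[ b ]
if-𝟙 true  true  = refl
if-𝟙 true  false = refl
if-𝟙 false true  = refl
if-𝟙 false false = refl

sum-zip-upTo : (l : List B) (x : ℕ) (g : B → ℕ) →
  sum (map (λ q → 𝟙[ ⌊ x ≟ proj₁ q ⌋ ] * g (proj₂ q)) (zip (upTo (length l)) l)) ≡ maybe′ g 0 (lookupMaybe l x)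
sum-zip-upTo []      x g = refl
sum-zip-upTo {B} (y ∷ l) x g = begin
    sum (map at (zip (upTo (suc (length l))) (y ∷ l)))
  ≡⟨ cong (λ z → sum (map at (zip z (y ∷ l)))) (upTo-suc (length l)) ⟩
    at (0 , y) + sum (map at (zip (map suc (upTo (length l))) l))
  ≡⟨ cong (λ z → at (0 , y) + sum (map at z)) (zip-mapˡ suc (upTo (length l)) l) ⟩
    at (0 , y) + sum (map at (map (λ q → suc (proj₁ q) , proj₂ q) (zip (upTo (length l)) l)))
  ≡⟨ cong (at (0 , y) +_) (sum-map-map at (λ q → suc (proj₁ q) , proj₂ q) (zip (upTo (length l)) l)) ⟩
    𝟙[ ⌊ x ≟ 0 ⌋ ] * g y + sum (map (λ q → 𝟙[ ⌊ x ≟ suc (proj₁ q) ⌋ ] * g (proj₂ q)) (zip (upTo (length l)) l))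
  ≡⟨ shift x ⟩
    maybe′ g 0 (lookupMaybe (y ∷ l) x) ∎
  where
  open ≡-Reasoning
  at : ℕ × B → ℕ
  at q = 𝟙[ ⌊ x ≟ proj₁ q ⌋ ] * g (proj₂ q)
  shift : (x : ℕ) →
    𝟙[ ⌊ x ≟ 0 ⌋ ] * g y + sum (map (λ q → 𝟙[ ⌊ x ≟ suc (proj₁ q) ⌋ ] * g (proj₂ q)) (zip (upTo (length l)) l))
      ≡ maybe′ g 0 (lookupMaybe (y ∷ l) x)
  shift zero = trans (cong₂ _+_ (+-identityʳ (g y)) (sum-map-zero (zip (upTo (length l)) l)
                 (λ q _ → cong (_* g (proj₂ q)) (𝟙-no (0 ≟ suc (proj₁ q)) (λ ()))))) (+-identityʳ (g y))
  shift (suc x) = trans (sum-map-cong (zip (upTo (length l)) l) (λ q → cong (λ b → 𝟙[ b ] * g (proj₂ q))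
                          (⌊⌋-cong-⇔ (suc x ≟ suc (proj₁ q)) (x ≟ proj₁ q) suc-injective (cong suc))))
                        (sum-zip-upTo l x g)

All-toList⇒lookup : {P : A → Set} {ℓ : ℕ} (r : Vec A ℓ) → All P (toList r) → ∀ v → P (Vec.lookup r v)
All-toList⇒lookup (x ∷ r) (px ∷ _)   zero    = px
All-toList⇒lookup (x ∷ r) (_  ∷ pxs) (suc v) = All-toList⇒lookup r pxs v

prodFin-cong : (N : ℕ) {f g : Fin N → ℕ} → (∀ i → f i ≡ g i) → prodFin N f ≡ prodFin N g
prodFin-cong N f≗g = cong product (map-cong f≗g (allFin N))

all?-cong : (N : ℕ) (α f g : Fin N → ℕ) → (∀ i → f i ≡ g i) →
  ⌊ all? (λ i → α i ≟ f i) ⌋ ≡ ⌊ all? (λ i → α i ≟ g i) ⌋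
all?-cong N α f g f≗g = ⌊⌋-cong-⇔ (all? (λ i → α i ≟ f i)) (all? (λ i → α i ≟ g i))
  (λ h i → trans (h i) (f≗g i)) (λ h i → trans (h i) (sym (f≗g i)))

map-proj₁-zip : (xs : List A) (ys : List B) → length ys ≡ length xs → map proj₁ (zip xs ys) ≡ xs
map-proj₁-zip []       []       _ = refl
map-proj₁-zip (x ∷ xs) (y ∷ ys) e = cong (x ∷_) (map-proj₁-zip xs ys (suc-injective e))

map-proj₂-zip : (xs : List A) (ys : List B) → length ys ≡ length xs → map proj₂ (zip xs ys) ≡ ys
map-proj₂-zip []       []       _ = refl
map-proj₂-zip (x ∷ xs) (y ∷ ys) e = cong (y ∷_) (map-proj₂-zip xs ys (suc-injective e))

module MonomialCoefficient (N : ℕ) (α β : Fin N → ℕ) where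

  Assignment : Set
  Assignment = List (Pair × Fin N)

  xExponentOf tExponentOf : Assignment → Fin N → ℕ
  xExponentOf a i = sum (map (λ q → if ⌊ proj₂ q ≟F i ⌋ then proj₁ (proj₁ q) else 0) a)
  tExponentOf a i = sum (map (λ q → if ⌊ proj₂ q ≟F i ⌋ then proj₂ (proj₁ q) else 0) a)

  assignmentTerm : Assignment → ℕ
  assignmentTerm a = if distinct (map proj₂ a) ∧ ⌊ all? (λ i → α i ≟ xExponentOf a i) ⌋
                     then prodFin N (λ i → tExponentOf a i C β i) else 0

  xExponent tExponent : List Pair → List (Fin N) → Fin N → ℕ
  xExponent τ l = xExponentOf (zip τ l)
  tExponent τ l = tExponentOf (zip τ l)

  monomialTerm : List Pair → List (Fin N) → ℕ
  monomialTerm τ l = if distinct l ∧ ⌊ all? (λ i → α i ≟ xExponent τ l i) ⌋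
                     then prodFin N (λ i → tExponent τ l i C β i) else 0

  assignmentTerm-↭ : {a a′ : Assignment} → a ↭ a′ → assignmentTerm a ≡ assignmentTerm a′
  assignmentTerm-↭ {a} {a′} a↭a′ = cong₃ (λ b₁ b₂ x → if b₁ ∧ b₂ then x else 0)
      (⌊⌋-cong-⇔ (UniqueDec.unique? _≟F_ (map proj₂ a)) (UniqueDec.unique? _≟F_ (map proj₂ a′))
                 (Unique-resp-↭ (map⁺ proj₂ a↭a′)) (Unique-resp-↭ (map⁺ proj₂ (↭-sym a↭a′))))
      (all?-cong N α (xExponentOf a) (xExponentOf a′)
                 (λ i → sum-↭ (map⁺ (λ q → if ⌊ proj₂ q ≟F i ⌋ then proj₁ (proj₁ q) else 0) a↭a′)))
      (prodFin-cong N (λ i → cong (_C β i) (sum-↭ (map⁺ (λ q → if ⌊ proj₂ q ≟F i ⌋ then proj₂ (proj₁ q) else 0) a↭a′))))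
    where
    cong₃ : {X Y Z W : Set} (f : X → Y → Z → W) {x x′ : X} {y y′ : Y} {z z′ : Z} →
      x ≡ x′ → y ≡ y′ → z ≡ z′ → f x y z ≡ f x′ y′ z′
    cong₃ f refl refl refl = refl
    Unique-resp-↭ : {xs ys : List (Fin N)} → xs ↭ ys → Unique xs → Unique ys
    Unique-resp-↭ xs↭ys = PermutationSetoid.Unique-resp-↭ (setoid (Fin N)) (↭⇒↭ₛ xs↭ys)

  -- Generalises coeffM (the case pre = []) so that invariance under permutations goes by induction.
  prefixedCoeff : List Pair → Assignment → ℕ
  prefixedCoeff τ pre = sum (map (λ ι → assignmentTerm (pre ++ zip τ (toList ι))) (vecs N (length τ)))

  coeffM≡prefixedCoeff : (τ : List Pair) → coeffM τ N α β ≡ prefixedCoeff τ []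
  coeffM≡prefixedCoeff τ = sum-map-cong (vecs N (length τ)) (λ ι →
    cong (λ l → if distinct l ∧ ⌊ all? (λ i → α i ≟ xExponent τ (toList ι) i) ⌋
                then prodFin N (λ i → tExponent τ (toList ι) i C β i) else 0)
         (sym (map-proj₂-zip τ (toList ι) (Vecₚ.length-toList ι))))

  prefixedCoeff-↭ʳ : (τ : List Pair) {pre pre′ : Assignment} → pre ↭ pre′ → prefixedCoeff τ pre ≡ prefixedCoeff τ pre′
  prefixedCoeff-↭ʳ τ pre↭pre′ = sum-map-cong (vecs N (length τ)) (λ ι → assignmentTerm-↭ (++⁺ʳ (zip τ (toList ι)) pre↭pre′))

  prefixedCoeff-∷ : (p : Pair) (τ : List Pair) (pre : Assignment) →
    prefixedCoeff (p ∷ τ) pre ≡ sum (map (λ i → prefixedCoeff τ (pre ++ (p , i) ∷ [])) (allFin N))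
  prefixedCoeff-∷ p τ pre = trans (sum-map-vecs-suc N (length τ) (λ ι → assignmentTerm (pre ++ zip (p ∷ τ) (toList ι))))
    (sum-map-cong (allFin N) (λ i → sum-map-cong (vecs N (length τ)) (λ ι →
      cong assignmentTerm (sym (++-assoc pre ((p , i) ∷ []) (zip τ (toList ι)))))))

  prefixedCoeff-↭ˡ : {τ τ′ : List Pair} → τ ↭ τ′ → (pre : Assignment) → prefixedCoeff τ pre ≡ prefixedCoeff τ′ pre
  prefixedCoeff-↭ˡ ↭.refl pre = refl
  prefixedCoeff-↭ˡ (↭.trans τ↭ τ′↭) pre = trans (prefixedCoeff-↭ˡ τ↭ pre) (prefixedCoeff-↭ˡ τ′↭ pre)
  prefixedCoeff-↭ˡ {p ∷ τ} {p ∷ τ′} (↭.prep p τ↭τ′) pre =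
    trans (prefixedCoeff-∷ p τ pre) (trans (sum-map-cong (allFin N) (λ i → prefixedCoeff-↭ˡ τ↭τ′ (pre ++ (p , i) ∷ [])))
                                           (sym (prefixedCoeff-∷ p τ′ pre)))
  prefixedCoeff-↭ˡ {p ∷ q ∷ τ} {q ∷ p ∷ τ′} (↭.swap p q τ↭τ′) pre = begin
      prefixedCoeff (p ∷ q ∷ τ) pre
    ≡⟨ prefixedCoeff-∷ p (q ∷ τ) pre ⟩
      sum (map (λ i → prefixedCoeff (q ∷ τ) (pre ++ (p , i) ∷ [])) (allFin N))
    ≡⟨ sum-map-cong (allFin N) (λ i → prefixedCoeff-∷ q τ (pre ++ (p , i) ∷ [])) ⟩
      sum (map (λ i → sum (map (λ j → prefixedCoeff τ ((pre ++ (p , i) ∷ []) ++ (q , j) ∷ [])) (allFin N))) (allFin N))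
    ≡⟨ sum-map-cong (allFin N) (λ i → sum-map-cong (allFin N) (λ j →
         trans (prefixedCoeff-↭ˡ τ↭τ′ _) (prefixedCoeff-↭ʳ τ′ (swapLast i j)))) ⟩
      sum (map (λ i → sum (map (λ j → prefixedCoeff τ′ ((pre ++ (q , j) ∷ []) ++ (p , i) ∷ [])) (allFin N))) (allFin N))
    ≡⟨ sum-map-swap (λ i j → prefixedCoeff τ′ ((pre ++ (q , j) ∷ []) ++ (p , i) ∷ [])) (allFin N) (allFin N) ⟩
      sum (map (λ j → sum (map (λ i → prefixedCoeff τ′ ((pre ++ (q , j) ∷ []) ++ (p , i) ∷ [])) (allFin N))) (allFin N))
    ≡⟨ sum-map-cong (allFin N) (λ j → sym (prefixedCoeff-∷ p τ′ (pre ++ (q , j) ∷ []))) ⟩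
      sum (map (λ j → prefixedCoeff (p ∷ τ′) (pre ++ (q , j) ∷ [])) (allFin N))
    ≡⟨ sym (prefixedCoeff-∷ q (p ∷ τ′) pre) ⟩
      prefixedCoeff (q ∷ p ∷ τ′) pre ∎
    where
    open ≡-Reasoning
    swapLast : ∀ i j → (pre ++ (p , i) ∷ []) ++ (q , j) ∷ [] ↭ (pre ++ (q , j) ∷ []) ++ (p , i) ∷ []
    swapLast i j rewrite ++-assoc pre ((p , i) ∷ []) ((q , j) ∷ []) | ++-assoc pre ((q , j) ∷ []) ((p , i) ∷ []) =
      ++⁺ˡ pre (↭-swap (p , i) (q , j) ↭-refl)

  coeffM-↭ : {τ τ′ : List Pair} → τ ↭ τ′ → coeffM τ N α β ≡ coeffM τ′ N α β
  coeffM-↭ {τ} {τ′} τ↭τ′ = trans (coeffM≡prefixedCoeff τ) (trans (prefixedCoeff-↭ˡ τ↭τ′ []) (sym (coeffM≡prefixedCoeff τ′)))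

module Coefficients (n m : ℕ) (ends : Fin m → Fin n × Fin n) (N : ℕ) (α β : Fin N → ℕ) where

  open BlockColourings n N
  open MonomialCoefficient N α β

  -- The summand of coeffY.
  colouringTerm : Vec (Fin N) n → ℕ
  colouringTerm χ = if ⌊ all? (λ i → α i ≟ colourClassSize n N χ i) ⌋
                    then prodFin N (λ i → monoEdges n m N ends χ i C β i) else 0

  module Partition (r : Vec (Fin n) n) (k : ℕ) (valid : rgs 0 (labels r) ≡ just k) where

    block : Fin n → ℕ
    block v = toℕ (Vec.lookup r v)

    block<k : ∀ v → block v < k
    block<k = All-toList⇒lookup r (Allₚ.map⁻ (rgs-bounded 0 (labels r) valid))

    blockPair : ℕ → Pair
    blockPair b = countFin n (λ v → ⌊ block v ≟ b ⌋)
                , countFin m (λ e → ⌊ block (proj₁ (ends e)) ≟ b ⌋ ∧ ⌊ block (proj₂ (ends e)) ≟ b ⌋)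

    pairs : List Pair
    pairs = blockPairs n m ends r k

    length-pairs : length pairs ≡ k
    length-pairs = trans (length-map blockPair (upTo k)) (length-upTo k)

    module _ (l : List (Fin N)) (|l|≡k : length l ≡ k) (χ : Vec (Fin N) n)
             (χ-spec : ∀ v → lookupMaybe l (block v) ≡ just (Vec.lookup χ v)) where

      sum-zip-pairs : (h : Pair × Fin N → ℕ) →
        sum (map h (zip pairs l)) ≡ sum (map (λ q → h (blockPair (proj₁ q) , proj₂ q)) (zip (upTo (length l)) l))
      sum-zip-pairs h = begin
          sum (map h (zip (map blockPair (upTo k)) l))
        ≡⟨ cong (sum ∘ map h) (zip-mapˡ blockPair (upTo k) l) ⟩
          sum (map h (map (λ q → blockPair (proj₁ q) , proj₂ q) (zip (upTo k) l)))
        ≡⟨ sum-map-map h (λ q → blockPair (proj₁ q) , proj₂ q) (zip (upTo k) l) ⟩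
          sum (map (λ q → h (blockPair (proj₁ q) , proj₂ q)) (zip (upTo k) l))
        ≡⟨ cong (λ j → sum (map (λ q → h (blockPair (proj₁ q) , proj₂ q)) (zip (upTo j) l))) (sym |l|≡k) ⟩
          sum (map (λ q → h (blockPair (proj₁ q) , proj₂ q)) (zip (upTo (length l)) l)) ∎
        where open ≡-Reasoning

      xExponent-pairs : (i : Fin N) → xExponent pairs l i ≡ colourClassSize n N χ i
      xExponent-pairs i = begin
          xExponent pairs l i
        ≡⟨ sum-zip-pairs (λ q → if ⌊ proj₂ q ≟F i ⌋ then proj₁ (proj₁ q) else 0) ⟩
          sum (map (λ q → if ⌊ proj₂ q ≟F i ⌋ then sum (map (λ v → 𝟙[ ⌊ block v ≟ proj₁ q ⌋ ]) (allFin n)) else 0) Z)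
        ≡⟨ sum-map-cong Z (λ q → if-sum ⌊ proj₂ q ≟F i ⌋ (λ v → 𝟙[ ⌊ block v ≟ proj₁ q ⌋ ]) (allFin n)) ⟩
          sum (map (λ q → sum (map (λ v → if ⌊ proj₂ q ≟F i ⌋ then 𝟙[ ⌊ block v ≟ proj₁ q ⌋ ] else 0) (allFin n))) Z)
        ≡⟨ sum-map-swap (λ q v → if ⌊ proj₂ q ≟F i ⌋ then 𝟙[ ⌊ block v ≟ proj₁ q ⌋ ] else 0) Z (allFin n) ⟩
          sum (map (λ v → sum (map (λ q → if ⌊ proj₂ q ≟F i ⌋ then 𝟙[ ⌊ block v ≟ proj₁ q ⌋ ] else 0) Z)) (allFin n))
        ≡⟨ sum-map-cong (allFin n) (λ v → sum-map-cong Z (λ q → if-𝟙 ⌊ proj₂ q ≟F i ⌋ ⌊ block v ≟ proj₁ q ⌋)) ⟩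
          sum (map (λ v → sum (map (λ q → 𝟙[ ⌊ block v ≟ proj₁ q ⌋ ] * 𝟙[ ⌊ proj₂ q ≟F i ⌋ ]) Z)) (allFin n))
        ≡⟨ sum-map-cong (allFin n) (λ v → trans (sum-zip-upTo l (block v) (λ y → 𝟙[ ⌊ y ≟F i ⌋ ]))
                                                (cong (maybe′ (λ y → 𝟙[ ⌊ y ≟F i ⌋ ]) 0) (χ-spec v))) ⟩
          colourClassSize n N χ i ∎
        where
        open ≡-Reasoning
        Z : List (ℕ × Fin N)
        Z = zip (upTo (length l)) l

      -- An edge lies inside block b of colour i iff its first end is in block b, both ends share
      -- a block, and that block has colour i.
      edgeIndicator : (a b′ b : ℕ) (B : Bool) →
        (if B then 𝟙[ ⌊ a ≟ b ⌋ ∧ ⌊ b′ ≟ b ⌋ ] else 0) ≡ 𝟙[ ⌊ a ≟ b ⌋ ] * (𝟙[ ⌊ b′ ≟ a ⌋ ] * 𝟙[ B ])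
      edgeIndicator a b′ b B with a ≟ b | b′ ≟ b | b′ ≟ a
      ... | yes refl | yes refl | yes refl = trans (if-𝟙 B true) (sym (*-identityˡ (1 * 𝟙[ B ])))
      ... | yes refl | yes refl | no b≢b   = ⊥-elim (b≢b refl)
      ... | yes refl | no b′≢b  | yes refl = ⊥-elim (b′≢b refl)
      ... | yes refl | no _     | no _     = trans (if-𝟙 B false) (sym (*-zeroʳ 1))
      ... | no _     | _        | _        = if-𝟙 B false

      tExponent-pairs : Unique l → (i : Fin N) → tExponent pairs l i ≡ monoEdges n m N ends χ i
      tExponent-pairs u i = begin
          tExponent pairs l i
        ≡⟨ sum-zip-pairs (λ q → if ⌊ proj₂ q ≟F i ⌋ then proj₂ (proj₁ q) else 0) ⟩
          sum (map (λ q → if ⌊ proj₂ q ≟F i ⌋ then sum (map (λ e → inside e (proj₁ q)) (allFin m)) else 0) Z)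
        ≡⟨ sum-map-cong Z (λ q → if-sum ⌊ proj₂ q ≟F i ⌋ (λ e → inside e (proj₁ q)) (allFin m)) ⟩
          sum (map (λ q → sum (map (λ e → if ⌊ proj₂ q ≟F i ⌋ then inside e (proj₁ q) else 0) (allFin m))) Z)
        ≡⟨ sum-map-swap (λ q e → if ⌊ proj₂ q ≟F i ⌋ then inside e (proj₁ q) else 0) Z (allFin m) ⟩
          sum (map (λ e → sum (map (λ q → if ⌊ proj₂ q ≟F i ⌋ then inside e (proj₁ q) else 0) Z)) (allFin m))
        ≡⟨ sum-map-cong (allFin m) (λ e → sum-map-cong Z (λ q → edgeIndicator (end₁ e) (end₂ e) (proj₁ q) ⌊ proj₂ q ≟F i ⌋)) ⟩
          sum (map (λ e → sum (map (λ q → 𝟙[ ⌊ end₁ e ≟ proj₁ q ⌋ ] * (𝟙[ ⌊ end₂ e ≟ end₁ e ⌋ ] * 𝟙[ ⌊ proj₂ q ≟F i ⌋ ])) Z)) (allFin m))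
        ≡⟨ sum-map-cong (allFin m) (λ e → trans (sum-zip-upTo l (end₁ e) (λ y → 𝟙[ ⌊ end₂ e ≟ end₁ e ⌋ ] * 𝟙[ ⌊ y ≟F i ⌋ ]))
                                                 (monochromatic e)) ⟩
          monoEdges n m N ends χ i ∎
        where
        open ≡-Reasoning
        Z : List (ℕ × Fin N)
        Z = zip (upTo (length l)) l
        end₁ end₂ : Fin m → ℕ
        end₁ e = block (proj₁ (ends e))
        end₂ e = block (proj₂ (ends e))
        inside : Fin m → ℕ → ℕ
        inside e b = 𝟙[ ⌊ end₁ e ≟ b ⌋ ∧ ⌊ end₂ e ≟ b ⌋ ]
        -- Both ends have colour i iff they lie in one block of colour i, as the blocks have distinct colours.
        monochromatic : (e : Fin m) →
          maybe′ (λ y → 𝟙[ ⌊ end₂ e ≟ end₁ e ⌋ ] * 𝟙[ ⌊ y ≟F i ⌋ ]) 0 (lookupMaybe l (end₁ e)) ≡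
          𝟙[ ⌊ Vec.lookup χ (proj₁ (ends e)) ≟F i ⌋ ∧ ⌊ Vec.lookup χ (proj₂ (ends e)) ≟F i ⌋ ]
        monochromatic e rewrite χ-spec (proj₁ (ends e))
          with end₂ e ≟ end₁ e | Vec.lookup χ (proj₁ (ends e)) ≟F i | Vec.lookup χ (proj₂ (ends e)) ≟F i
        ... | yes _     | yes _  | yes _  = refl
        ... | yes same  | yes c₁ | no ¬c₂ = ⊥-elim (¬c₂ (trans (just-injective
                (trans (sym (χ-spec (proj₂ (ends e)))) (trans (cong (lookupMaybe l) same) (χ-spec (proj₁ (ends e)))))) c₁))
        ... | yes _     | no _   | _      = refl
        ... | no ¬same  | yes c₁ | yes c₂ = ⊥-elim (¬same (lookupMaybe-injective l u (end₂ e) (end₁ e)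
                (trans (χ-spec (proj₂ (ends e))) (cong just (trans c₂ (sym c₁)))) (χ-spec (proj₁ (ends e)))))
        ... | no _      | yes _  | no _   = refl
        ... | no _      | no _   | _      = refl

    monomialTerm≡extensionTerm : (d : Vec (Fin N) k) →
      monomialTerm pairs (toList d) ≡ extensionTerm [] r colouringTerm (toList d)
    monomialTerm≡extensionTerm d with UniqueDec.unique? _≟F_ (toList d)
    ... | no _  = refl
    ... | yes u with χ , e , χ-spec ← colouring-just (toList d) r (λ v → subst (block v <_) (sym (Vecₚ.length-toList d)) (block<k v))
                rewrite e =
      cong₂ (λ b x → if b then x else 0)
        (all?-cong N α (xExponent pairs (toList d)) (colourClassSize n N χ) (xExponent-pairs (toList d) (Vecₚ.length-toList d) χ χ-spec))
        (prodFin-cong N (λ i → cong (_C β i) (tExponent-pairs (toList d) (Vecₚ.length-toList d) χ χ-spec u i)))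

    coeffM-pairs : coeffM pairs N α β ≡ extensionSum [] r colouringTerm (just k)
    coeffM-pairs = trans (cong (λ j → sum (map (λ d → monomialTerm pairs (toList d)) (vecs N j))) length-pairs)
                         (sum-map-cong (vecs N k) monomialTerm≡extensionTerm)

  module SortedPartition (r : Vec (Fin n) n) (k : ℕ) (valid : rgs 0 (labels r) ≡ just k) where

    open Partition r k valid

    pairs-positive : All (λ p → 1 ≤ proj₁ p) pairs
    pairs-positive = Allₚ.map⁺ (All.tabulate (λ {b} b∈ → nonempty b (∈-upTo⁻ b∈)))
      where
      nonempty : ∀ b → b < k → 1 ≤ proj₁ (blockPair b)
      nonempty b b<k with v , e ← ∈-labels⁻ r (rgs-surjective 0 (labels r) valid b z≤n b<k) =
        ≤-trans (≤-reflexive (sym (𝟙-yes (block v ≟ b) e))) (∈⇒≤-sum-map (λ v → 𝟙[ ⌊ block v ≟ b ⌋ ]) (allFin n) (∈-allFin v))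

    sum-sizes : sum (map proj₁ pairs) ≡ n
    sum-sizes = begin
        sum (map proj₁ (map blockPair (upTo k)))
      ≡⟨ sum-map-map proj₁ blockPair (upTo k) ⟩
        sum (map (λ b → sum (map (λ v → 𝟙[ ⌊ block v ≟ b ⌋ ]) (allFin n))) (upTo k))
      ≡⟨ sum-map-swap (λ b v → 𝟙[ ⌊ block v ≟ b ⌋ ]) (upTo k) (allFin n) ⟩
        sum (map (λ v → sum (map (λ b → 𝟙[ ⌊ block v ≟ b ⌋ ]) (upTo k))) (allFin n))
      ≡⟨ sum-map-cong (allFin n) (λ v → multiplicity-upTo k (block v) (block<k v)) ⟩
        sum (map (λ _ → 1) (allFin n))
      ≡⟨ trans (sum-map-1 (allFin n)) (Listₚ.length-tabulate id) ⟩
        n ∎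
      where open ≡-Reasoning

    sum-edges≤ : sum (map proj₂ pairs) ≤ m
    sum-edges≤ = begin
        sum (map proj₂ (map blockPair (upTo k)))
      ≡⟨ sum-map-map proj₂ blockPair (upTo k) ⟩
        sum (map (λ b → sum (map (λ e → 𝟙[ ⌊ end₁ e ≟ b ⌋ ∧ ⌊ end₂ e ≟ b ⌋ ]) (allFin m))) (upTo k))
      ≡⟨ sum-map-swap (λ b e → 𝟙[ ⌊ end₁ e ≟ b ⌋ ∧ ⌊ end₂ e ≟ b ⌋ ]) (upTo k) (allFin m) ⟩
        sum (map (λ e → sum (map (λ b → 𝟙[ ⌊ end₁ e ≟ b ⌋ ∧ ⌊ end₂ e ≟ b ⌋ ]) (upTo k))) (allFin m))
      ≤⟨ sum-map-mono-≤ (allFin m) (λ e _ → sum-map-mono-≤ (upTo k) (λ b _ → 𝟙-∧-≤ˡ ⌊ end₁ e ≟ b ⌋ ⌊ end₂ e ≟ b ⌋)) ⟩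
        sum (map (λ e → sum (map (λ b → 𝟙[ ⌊ end₁ e ≟ b ⌋ ]) (upTo k))) (allFin m))
      ≡⟨ sum-map-cong (allFin m) (λ e → multiplicity-upTo k (end₁ e) (block<k (proj₁ (ends e)))) ⟩
        sum (map (λ _ → 1) (allFin m))
      ≡⟨ trans (sum-map-1 (allFin m)) (Listₚ.length-tabulate id) ⟩
        m ∎
      where
      open ≤-Reasoning
      end₁ end₂ : Fin m → ℕ
      end₁ e = block (proj₁ (ends e))
      end₂ e = block (proj₂ (ends e))

    IsIPP-sort : IsIPP n m (sort pairs)
    IsIPP-sort = All-resp-↭ (↭-sym (sort-↭ pairs)) pairs-positive
               , trans (sum-↭ (map⁺ proj₁ (sort-↭ pairs))) sum-sizes
               , ≤-trans (≤-reflexive (sum-↭ (map⁺ proj₂ (sort-↭ pairs)))) sum-edges≤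
               , sort-↗ pairs

    -- The only integer pair partition with the monomial of the partition is its sorted list of pairs.
    sum-ipps-sameMonomial : sum (map (λ τ → 𝟙[ sameMonomial pairs τ ] * coeffM τ N α β) (ipps n m)) ≡ coeffM pairs N α β
    sum-ipps-sameMonomial = begin
        sum (map term (ipps n m))
      ≡⟨ sum-map-supported-at (Listₚ.≡-dec _≟P_) (sort pairs) term (ipps n m) offSorted ⟩
        multiplicity (Listₚ.≡-dec _≟P_) (sort pairs) (ipps n m) * term (sort pairs)
      ≡⟨ cong₂ _*_ (multiplicity-ipps n m (sort pairs) IsIPP-sort)
                   (cong₂ _*_ (cong 𝟙[_] (↭⇒sameMonomial pairs (sort pairs) (↭-sym (sort-↭ pairs)))) (coeffM-↭ (sort-↭ pairs))) ⟩
        1 * (1 * coeffM pairs N α β)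
      ≡⟨ trans (*-identityˡ _) (*-identityˡ _) ⟩
        coeffM pairs N α β ∎
      where
      open ≡-Reasoning
      term : List Pair → ℕ
      term τ = 𝟙[ sameMonomial pairs τ ] * coeffM τ N α β
      offSorted : ∀ τ → τ ∈ ipps n m → ¬ τ ≡ sort pairs → term τ ≡ 0
      offSorted τ τ∈ τ≢ with sameMonomial pairs τ in same
      ... | false = refl
      ... | true  = ⊥-elim (τ≢ (sym (sorted-↭⇒≡ (sort-↗ pairs) (proj₂ (proj₂ (proj₂ (∈-ipps⇒IsIPP n m τ∈))))
                                                 (↭-trans (sort-↭ pairs) (sameMonomial⇒↭ pairs τ same)))))

-- Triangularity of the augmented monomials

Unique-⊆-↭ : (xs ys : List A) → Unique xs → Unique ys → (∀ {z} → z ∈ xs → z ∈ ys) → (∀ {z} → z ∈ ys → z ∈ xs) → xs ↭ ys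
Unique-⊆-↭ xs ys xs! ys! xs⊆ys ys⊆xs = ∼bag⇒↭ (unique∧set⇒bag xs! ys! (mk⇔ xs⊆ys ys⊆xs))

∈-zip-lookup : (τ : List A) (f : Fin (length τ) → B) (j : Fin (length τ)) →
  (List.lookup τ j , f j) ∈ zip τ (List.tabulate f)
∈-zip-lookup (x ∷ τ) f zero    = here refl
∈-zip-lookup (x ∷ τ) f (suc j) = there (∈-zip-lookup τ (f ∘ suc) j)

toList-tabulate : (k : ℕ) (f : Fin k → A) → toList (Vec.tabulate f) ≡ List.tabulate f
toList-tabulate zero    f = refl
toList-tabulate (suc k) f = cong (f zero ∷_) (toList-tabulate k (f ∘ suc))

sum-map-lookup : (τ : List A) (g : A → ℕ) → sum (map (g ∘ List.lookup τ) (allFin (length τ))) ≡ sum (map g τ)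
sum-map-lookup τ g = cong sum (trans (map-tabulate id (g ∘ List.lookup τ))
  (trans (sym (map-tabulate (List.lookup τ) g)) (cong (map g) (Listₚ.tabulate-lookup τ))))

sum-assignment-at : {k : ℕ} (h : Pair → ℕ) (a : List (Pair × Fin k)) → Unique (map proj₂ a) →
  {p : Pair} {j : Fin k} → (p , j) ∈ a → sum (map (λ q → if ⌊ proj₂ q ≟F j ⌋ then h (proj₁ q) else 0) a) ≡ h p
sum-assignment-at h ((p , j) ∷ a) u (here refl) =
  trans (cong₂ _+_ (atJ (j ≟F j)) (sum-map-zero a (λ q q∈ → offJ (proj₂ q ≟F j)
    (λ { refl → Unique[x∷xs]⇒x∉xs u (∈-map⁺ proj₂ q∈) })))) (+-identityʳ _)
  where
  atJ : (d : Dec (j ≡ j)) → (if ⌊ d ⌋ then h p else 0) ≡ h p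
  atJ (yes _)  = refl
  atJ (no j≢j) = ⊥-elim (j≢j refl)
  offJ : {x : ℕ} {i : Fin _} (d : Dec (i ≡ j)) → ¬ i ≡ j → (if ⌊ d ⌋ then x else 0) ≡ 0
  offJ (yes i≡j) i≢j = ⊥-elim (i≢j i≡j)
  offJ (no _)    _   = refl
sum-assignment-at h ((p₀ , j₀) ∷ a) u@(_ ∷ u′) {j = j} (there pj∈) = cong₂ _+_ (offJ (j₀ ≟F j)) (sum-assignment-at h a u′ pj∈)
  where
  offJ : (d : Dec (j₀ ≡ j)) → (if ⌊ d ⌋ then h p₀ else 0) ≡ 0
  offJ (yes refl) = ⊥-elim (Unique[x∷xs]⇒x∉xs u (∈-map⁺ proj₂ pj∈))
  offJ (no _)     = refl

sum-allFin-if≟ : (k : ℕ) (i : Fin k) (v : ℕ) → sum (map (λ j → if ⌊ i ≟F j ⌋ then v else 0) (allFin k)) ≡ v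
sum-allFin-if≟ k i v = begin
    sum (map (λ j → if ⌊ i ≟F j ⌋ then v else 0) (allFin k))
  ≡⟨ sum-map-supported-at _≟F_ i (λ j → if ⌊ i ≟F j ⌋ then v else 0) (allFin k) (λ j _ j≢i → off j j≢i) ⟩
    multiplicity _≟F_ i (allFin k) * (if ⌊ i ≟F i ⌋ then v else 0)
  ≡⟨ cong₂ _*_ (multiplicity-allFin k i) (at (i ≟F i)) ⟩
    1 * v
  ≡⟨ *-identityˡ v ⟩
    v ∎
  where
  open ≡-Reasoning
  off : ∀ j → ¬ j ≡ i → (if ⌊ i ≟F j ⌋ then v else 0) ≡ 0
  off j j≢i with i ≟F j
  ... | yes i≡j = ⊥-elim (j≢i (sym i≡j))
  ... | no _    = refl
  at : (d : Dec (i ≡ i)) → (if ⌊ d ⌋ then v else 0) ≡ v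
  at (yes _)  = refl
  at (no i≢i) = ⊥-elim (i≢i refl)

C≢0⇒≤ : (a b : ℕ) → ¬ a C b ≡ 0 → b ≤ a
C≢0⇒≤ a b aCb≢0 = ≮⇒≥ (λ a<b → aCb≢0 (k>n⇒nCk≡0 a<b))

module Diagonal (τ : List Pair) (τ-positive : All (λ p → 1 ≤ proj₁ p) τ) (τ↘ : Linked _≥lex_ τ) where

  k : ℕ
  k = length τ

  α β : Fin k → ℕ
  α j = proj₁ (List.lookup τ j)
  β j = proj₂ (List.lookup τ j)

  open MonomialCoefficient k α β

  edges : List Pair → ℕ
  edges σ = sum (map proj₂ σ)

  coeff : List Pair → ℕ
  coeff σ = coeffM σ k α β

  monomialTerm≢0 : (σ : List Pair) (l : List (Fin k)) → ¬ monomialTerm σ l ≡ 0 →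
    Unique l × (∀ j → α j ≡ xExponent σ l j) × (∀ j → β j ≤ tExponent σ l j)
  monomialTerm≢0 σ l term≢0 with UniqueDec.unique? _≟F_ l | all? (λ i → α i ≟ xExponent σ l i)
  ... | yes l! | yes α≡ = l! , α≡ , λ j →
          C≢0⇒≤ _ _ (product-map≢0⇒≢0 (λ i → tExponent σ l i C β i) (allFin k) term≢0 j (∈-allFin j))
  ... | yes _  | no _   = ⊥-elim (term≢0 refl)
  ... | no _   | _      = ⊥-elim (term≢0 refl)

  sum-tExponent : (σ : List Pair) (l : List (Fin k)) → length l ≡ length σ →
    sum (map (tExponent σ l) (allFin k)) ≡ edges σ
  sum-tExponent σ l |l|≡ = begin
      sum (map (λ j → sum (map (λ q → if ⌊ proj₂ q ≟F j ⌋ then proj₂ (proj₁ q) else 0) (zip σ l))) (allFin k))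
    ≡⟨ sum-map-swap (λ j q → if ⌊ proj₂ q ≟F j ⌋ then proj₂ (proj₁ q) else 0) (allFin k) (zip σ l) ⟩
      sum (map (λ q → sum (map (λ j → if ⌊ proj₂ q ≟F j ⌋ then proj₂ (proj₁ q) else 0) (allFin k))) (zip σ l))
    ≡⟨ sum-map-cong (zip σ l) (λ q → sum-allFin-if≟ k (proj₂ q) (proj₂ (proj₁ q))) ⟩
      sum (map (proj₂ ∘ proj₁) (zip σ l))
    ≡⟨ sum-map-map proj₂ proj₁ (zip σ l) ⟨
      sum (map proj₂ (map proj₁ (zip σ l)))
    ≡⟨ cong (sum ∘ map proj₂) (map-proj₁-zip σ l |l|≡) ⟩
      edges σ ∎
    where open ≡-Reasoning

  nonzeroTerm : (σ : List Pair) → ¬ coeff σ ≡ 0 → ∃ λ (ι : Vec (Fin k) (length σ)) → ¬ monomialTerm σ (toList ι) ≡ 0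
  nonzeroTerm σ coeff≢0 with ι , _ , term≢0 ← sum-map≢0⇒∃ (λ ι → monomialTerm σ (toList ι)) (vecs k (length σ)) coeff≢0 =
    ι , term≢0

  coeff≢0⇒edges≤ : (σ : List Pair) → ¬ coeff σ ≡ 0 → edges τ ≤ edges σ
  coeff≢0⇒edges≤ σ coeff≢0 with ι , term≢0 ← nonzeroTerm σ coeff≢0 with _ , _ , β≤ ← monomialTerm≢0 σ (toList ι) term≢0 = begin
      edges τ                                  ≡⟨ sum-map-lookup τ proj₂ ⟨
      sum (map β (allFin k))                   ≤⟨ sum-map-mono-≤ (allFin k) (λ j _ → β≤ j) ⟩
      sum (map (tExponent σ (toList ι)) (allFin k)) ≡⟨ sum-tExponent σ (toList ι) (Vecₚ.length-toList ι) ⟩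
      edges σ ∎
    where open ≤-Reasoning

  -- Equal edge totals force the exponents of t to be exact, so each colour j carries exactly the pair
  -- τ_j, and every colour occurs since each a_j ≥ 1; hence σ is a rearrangement of τ.
  coeff≢0⇒≡ : (σ : List Pair) → Linked _≥lex_ σ → edges σ ≡ edges τ → ¬ coeff σ ≡ 0 → σ ≡ τ
  coeff≢0⇒≡ σ σ↘ edges≡ coeff≢0 with ι , term≢0 ← nonzeroTerm σ coeff≢0 with l! , α≡ , β≤ ← monomialTerm≢0 σ (toList ι) term≢0 =
    sorted-↭⇒≡ σ↘ τ↘ σ↭τ
    where
    l : List (Fin k)
    l = toList ι
    |l|≡ : length l ≡ length σ
    |l|≡ = Vecₚ.length-toList ι
    a : List (Pair × Fin k)
    a = zip σ l
    colours : map proj₂ a ≡ l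
    colours = map-proj₂-zip σ l |l|≡
    a! : Unique (map proj₂ a)
    a! = subst Unique (sym colours) l!
    β≡ : ∀ j → β j ≡ tExponent σ l j
    β≡ j = sum-map-mono-≤-≡⇒≡ (allFin k) (λ j _ → β≤ j)
      (trans (sum-map-lookup τ proj₂) (trans (sym edges≡) (sym (sum-tExponent σ l |l|≡)))) j (∈-allFin j)
    covers : ∀ j → j ∈ l
    covers j with sum-map≢0⇒∃ (λ q → if ⌊ proj₂ q ≟F j ⌋ then proj₁ (proj₁ q) else 0) a
                    (λ x≡0 → ≤⇒≯ (≤-reflexive (trans (α≡ j) x≡0)) (All.lookup τ-positive (∈-lookup j)))
    ... | q , q∈ , q≢0 with proj₂ q ≟F j
    ...   | yes refl = subst (_ ∈_) colours (∈-map⁺ proj₂ q∈)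
    ...   | no _     = ⊥-elim (q≢0 refl)
    l↭allFin : l ↭ allFin k
    l↭allFin = Unique-⊆-↭ l (allFin k) l! (allFin⁺ k) (λ {z} _ → ∈-allFin z) (λ {z} _ → covers z)
    pairOf : ∀ q → q ∈ a → proj₁ q ≡ List.lookup τ (proj₂ q)
    pairOf (p , j) q∈ = cong₂ _,_ (trans (sym (sum-assignment-at proj₁ a a! q∈)) (sym (α≡ j)))
                                   (trans (sym (sum-assignment-at proj₂ a a! q∈)) (sym (β≡ j)))
    σ≡ : σ ≡ map (List.lookup τ) l
    σ≡ = begin
        σ                                        ≡⟨ map-proj₁-zip σ l |l|≡ ⟨
        map proj₁ a                              ≡⟨ map-cong-local (All.tabulate (λ {q} → pairOf q)) ⟩
        map (List.lookup τ ∘ proj₂) a            ≡⟨ map-∘ a ⟩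
        map (List.lookup τ) (map proj₂ a)        ≡⟨ cong (map (List.lookup τ)) colours ⟩
        map (List.lookup τ) l ∎
      where open ≡-Reasoning
    σ↭τ : σ ↭ τ
    σ↭τ = subst (_↭ τ) (sym σ≡) (subst (map (List.lookup τ) l ↭_)
            (trans (map-tabulate id (List.lookup τ)) (Listₚ.tabulate-lookup τ)) (map⁺ (List.lookup τ) l↭allFin))

  coeff-diagonal≢0 : ¬ coeff τ ≡ 0
  coeff-diagonal≢0 coeff≡0 = 1≰0 (subst (1 ≤_) coeff≡0
      (≤-trans (≤-reflexive (sym identityTerm)) (∈⇒≤-sum-map (λ ι → monomialTerm τ (toList ι)) (vecs k k) (∈-vecs k k ι₀))))
    where
    1≰0 : ¬ 1 ≤ 0
    1≰0 ()
    ι₀ : Vec (Fin k) k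
    ι₀ = Vec.tabulate id
    a₀ : List (Pair × Fin k)
    a₀ = zip τ (allFin k)
    a₀! : Unique (map proj₂ a₀)
    a₀! = subst Unique (sym (map-proj₂-zip τ (allFin k) (Listₚ.length-tabulate id))) (allFin⁺ k)
    α≡ : ∀ j → xExponent τ (allFin k) j ≡ α j
    α≡ j = sum-assignment-at proj₁ a₀ a₀! (∈-zip-lookup τ id j)
    β≡ : ∀ j → tExponent τ (allFin k) j ≡ β j
    β≡ j = sum-assignment-at proj₂ a₀ a₀! (∈-zip-lookup τ id j)
    allα : ⌊ all? (λ i → α i ≟ xExponent τ (allFin k) i) ⌋ ≡ true
    allα with all? (λ i → α i ≟ xExponent τ (allFin k) i)
    ... | yes _  = refl
    ... | no ¬α≡ = ⊥-elim (¬α≡ (λ j → sym (α≡ j)))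
    identityTerm : monomialTerm τ (toList ι₀) ≡ 1
    identityTerm rewrite toList-tabulate k id | BlockColourings.distinct-Unique 0 k (allFin k) (allFin⁺ k) | allα =
      product-map-1 (λ i → tExponent τ (allFin k) i C β i) (allFin k) (λ j _ → trans (cong (_C β j) (β≡ j)) (nCn≡1 (β j)))

-- Recovers the summand of a sum from its unfolding; used to name the local summand of coeffChi.
summandOf : {xs : List A} {s : ℕ} (f : A → ℕ) → s ≡ sum (map f xs) → A → ℕ
summandOf f _ = f

module Expansion (n m : ℕ) (ends : Fin m → Fin n × Fin n) where

  partitionIndicator : List Pair → Vec (Fin n) n → Maybe ℕ → ℕ
  partitionIndicator τ r nothing  = 0
  partitionIndicator τ r (just k) = 𝟙[ sameMonomial (blockPairs n m ends r k) τ ]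

  coeffChi-partitions : (τ : List Pair) →
    coeffChi n m ends τ ≡ sum (map (λ r → partitionIndicator τ r (rgs 0 (labels r))) (vecs n n))
  coeffChi-partitions τ = sum-map-cong (vecs n n) unfold
    where
    chiSummand : Vec (Fin n) n → ℕ
    chiSummand = summandOf {xs = vecs n n} {s = coeffChi n m ends τ} _ refl
    unfold : (r : Vec (Fin n) n) → chiSummand r ≡ partitionIndicator τ r (rgs 0 (labels r))
    unfold r with rgs 0 (labels r)
    ... | nothing = refl
    ... | just k  = refl

  coeffY-expansion : (N : ℕ) (α β : Fin N → ℕ) →
    coeffY n m ends N α β ≡ sum (map (λ τ → coeffChi n m ends τ * coeffM τ N α β) (ipps n m))
  coeffY-expansion N α β = begin
      sum (map colouringTerm (vecs N n))
    ≡⟨ decomposition n [] [] ≤-refl colouringTerm ⟩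
      sum (map (λ r → blockColouringSum [] r colouringTerm) (vecs n n))
    ≡⟨ sum-map-cong (vecs n n) (λ r → perPartition r (rgs 0 (labels r)) refl) ⟨
      sum (map (λ r → sum (map (λ τ → partitionIndicator τ r (rgs 0 (labels r)) * M τ) (ipps n m))) (vecs n n))
    ≡⟨ sum-map-swap (λ r τ → partitionIndicator τ r (rgs 0 (labels r)) * M τ) (vecs n n) (ipps n m) ⟩
      sum (map (λ τ → sum (map (λ r → partitionIndicator τ r (rgs 0 (labels r)) * M τ) (vecs n n))) (ipps n m))
    ≡⟨ sum-map-cong (ipps n m) (λ τ → trans (sum-map-*ʳ (M τ) (λ r → partitionIndicator τ r (rgs 0 (labels r))) (vecs n n))
                                            (cong (_* M τ) (sym (coeffChi-partitions τ)))) ⟩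
      sum (map (λ τ → coeffChi n m ends τ * M τ) (ipps n m)) ∎
    where
    open ≡-Reasoning
    open BlockColourings n N
    open Coefficients n m ends N α β
    M : List Pair → ℕ
    M τ = coeffM τ N α β
    perPartition : (r : Vec (Fin n) n) (x : Maybe ℕ) → rgs 0 (labels r) ≡ x →
      sum (map (λ τ → partitionIndicator τ r x * M τ) (ipps n m)) ≡ extensionSum [] r colouringTerm x
    perPartition r nothing  _     = sum-map-zero (ipps n m) (λ _ _ → refl)
    perPartition r (just k) valid = trans (SortedPartition.sum-ipps-sameMonomial r k valid) (Partition.coeffM-pairs r k valid)

-- Opened only here: its prefix +_ makes sections such as (x +_) ambiguous.
open import Data.Integer using (ℤ; +_; 0ℤ) renaming (_+_ to _+ℤ_; _*_ to _*ℤ_; _-_ to _-ℤ_)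
open import Data.Integer.Solver using (module +-*-Solver)
import Data.Integer.Properties as ℤ

sumℤ-map-pos-* : (f g : A → ℕ) (xs : List A) → sumℤ (map (λ x → + f x *ℤ + g x) xs) ≡ + sum (map (λ x → f x * g x) xs)
sumℤ-map-pos-* f g []       = refl
sumℤ-map-pos-* f g (x ∷ xs) = trans (cong₂ _+ℤ_ (ℤ.+◃n≡+n (f x * g x)) (sumℤ-map-pos-* f g xs)) (sym (ℤ.pos-+ (f x * g x) _))

coeffChi-isAugMonomialExpansion : (n m : ℕ) (ends : Fin m → Fin n × Fin n) →
  IsAugMonomialExpansion n m ends (λ τ → + coeffChi n m ends τ)
coeffChi-isAugMonomialExpansion n m ends N α β = trans (cong +_ (Expansion.coeffY-expansion n m ends N α β))
  (sym (sumℤ-map-pos-* (coeffChi n m ends) (λ τ → coeffM τ N α β) (ipps n m)))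

sumℤ-map-supported-at : (_≟A_ : DecidableEquality A) (y : A) (f : A → ℤ) (xs : List A) →
  (∀ x → x ∈ xs → ¬ x ≡ y → f x ≡ 0ℤ) → sumℤ (map f xs) ≡ + multiplicity _≟A_ y xs *ℤ f y
sumℤ-map-supported-at _≟A_ y f []       h = refl
sumℤ-map-supported-at _≟A_ y f (x ∷ xs) h with x ≟A y
... | yes refl = begin
    f x +ℤ sumℤ (map f xs)
  ≡⟨ cong (f x +ℤ_) (sumℤ-map-supported-at _≟A_ y f xs (λ z p → h z (there p))) ⟩
    f x +ℤ + μ *ℤ f x
  ≡⟨ cong (_+ℤ + μ *ℤ f x) (ℤ.*-identityˡ (f x)) ⟨
    + 1 *ℤ f x +ℤ + μ *ℤ f x
  ≡⟨ ℤ.*-distribʳ-+ (f x) (+ 1) (+ μ) ⟨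
    (+ 1 +ℤ + μ) *ℤ f x
  ≡⟨ cong (_*ℤ f x) (ℤ.pos-+ 1 μ) ⟨
    + (1 + μ) *ℤ f x ∎
  where
  open ≡-Reasoning
  μ : ℕ
  μ = multiplicity _≟A_ x xs
... | no x≢y = trans (cong₂ _+ℤ_ (h x (here refl) x≢y) (sumℤ-map-supported-at _≟A_ y f xs (λ z p → h z (there p))))
                     (ℤ.+-identityˡ _)

sumℤ-map-*-distribʳ-sub : (F G H : A → ℤ) (xs : List A) →
  sumℤ (map (λ x → (F x -ℤ G x) *ℤ H x) xs) ≡ sumℤ (map (λ x → F x *ℤ H x) xs) -ℤ sumℤ (map (λ x → G x *ℤ H x) xs)
sumℤ-map-*-distribʳ-sub F G H []       = refl
sumℤ-map-*-distribʳ-sub F G H (x ∷ xs) = trans (cong ((F x -ℤ G x) *ℤ H x +ℤ_) (sumℤ-map-*-distribʳ-sub F G H xs))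
  (regroup (F x) (G x) (H x) (sumℤ (map (λ x → F x *ℤ H x) xs)) (sumℤ (map (λ x → G x *ℤ H x) xs)))
  where
  open +-*-Solver
  regroup : ∀ a b h s t → (a -ℤ b) *ℤ h +ℤ (s -ℤ t) ≡ (a *ℤ h +ℤ s) -ℤ (b *ℤ h +ℤ t)
  regroup = solve 5 (λ a b h s t → (a :- b) :* h :+ (s :- t) := (a :* h :+ s) :- (b :* h :+ t)) refl

-- By strong induction on m ∸ Σ b(τ): every other τ′ either has coefficient zero at the exponents of τ
-- or more edges, where δ vanishes already; so the kernel equation at those exponents isolates δ τ.
augMonomials-independent : (n m : ℕ) (δ : List Pair → ℤ) →
  (∀ N (α β : Fin N → ℕ) → sumℤ (map (λ τ → δ τ *ℤ + coeffM τ N α β) (ipps n m)) ≡ 0ℤ) →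
  ∀ τ → IsIPP n m τ → δ τ ≡ 0ℤ
augMonomials-independent n m δ kernel τ ipp = <-rec Vanishes step (m ∸ edgesOf τ) τ ipp refl
  where
  edgesOf : List Pair → ℕ
  edgesOf σ = sum (map proj₂ σ)
  Vanishes : ℕ → Set
  Vanishes d = ∀ τ → IsIPP n m τ → m ∸ edgesOf τ ≡ d → δ τ ≡ 0ℤ
  step : ∀ d → (∀ {d′} → d′ < d → Vanishes d′) → Vanishes d
  step d IH τ ipp@(τ-positive , _ , _ , τ↘) refl = δτ≡0
    where
    open Diagonal τ τ-positive τ↘
    offDiagonal : ∀ σ → σ ∈ ipps n m → ¬ σ ≡ τ → δ σ *ℤ + coeff σ ≡ 0ℤ
    offDiagonal σ σ∈ σ≢τ with coeff σ ≟ 0 | ∈-ipps⇒IsIPP n m σ∈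
    ... | yes coeff≡0 | _ = trans (cong (λ x → δ σ *ℤ + x) coeff≡0) (ℤ.*-zeroʳ (δ σ))
    ... | no coeff≢0 | ippσ@(_ , _ , σ-edges≤ , σ↘) with edgesOf σ ≟ edgesOf τ
    ...   | yes edges≡ = ⊥-elim (σ≢τ (coeff≢0⇒≡ σ σ↘ edges≡ coeff≢0))
    ...   | no edges≢  = cong (_*ℤ + coeff σ) (IH (∸-monoʳ-< (≤∧≢⇒< (coeff≢0⇒edges≤ σ coeff≢0) (edges≢ ∘ sym)) σ-edges≤) σ ippσ refl)
    diagonal : δ τ *ℤ + coeff τ ≡ 0ℤ
    diagonal = begin
        δ τ *ℤ + coeff τ
      ≡⟨ ℤ.*-identityˡ _ ⟨
        + 1 *ℤ (δ τ *ℤ + coeff τ)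
      ≡⟨ cong (λ μ → + μ *ℤ (δ τ *ℤ + coeff τ)) (multiplicity-ipps n m τ ipp) ⟨
        + multiplicity (Listₚ.≡-dec _≟P_) τ (ipps n m) *ℤ (δ τ *ℤ + coeff τ)
      ≡⟨ sumℤ-map-supported-at (Listₚ.≡-dec _≟P_) τ (λ σ → δ σ *ℤ + coeff σ) (ipps n m) offDiagonal ⟨
        sumℤ (map (λ σ → δ σ *ℤ + coeff σ) (ipps n m))
      ≡⟨ kernel k α β ⟩
        0ℤ ∎
      where open ≡-Reasoning
    δτ≡0 : δ τ ≡ 0ℤ
    δτ≡0 with ℤ.i*j≡0⇒i≡0∨j≡0 (δ τ) diagonal
    ... | inj₁ δτ≡0    = δτ≡0
    ... | inj₂ coeff≡0 = ⊥-elim (coeff-diagonal≢0 (ℤ.+-injective coeff≡0))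

mainTheorem4 : (n m : ℕ) (ends : Fin m → Fin n × Fin n) (c : List Pair → ℤ) →
    IsAugMonomialExpansion n m ends c ⇔
      ((τ : List Pair) → IsIPP n m τ → c τ ≡ + coeffChi n m ends τ)
mainTheorem4 n m ends c = mk⇔ uniqueness existence
  where
  χ̄ : List Pair → ℤ
  χ̄ τ = + coeffChi n m ends τ
  uniqueness : IsAugMonomialExpansion n m ends c → ∀ τ → IsIPP n m τ → c τ ≡ χ̄ τ
  uniqueness expansion τ ipp = ℤ.i-j≡0⇒i≡j (c τ) (χ̄ τ) (augMonomials-independent n m (λ σ → c σ -ℤ χ̄ σ)
    (λ N α β → trans (sumℤ-map-*-distribʳ-sub c χ̄ (λ σ → + coeffM σ N α β) (ipps n m))
                     (ℤ.i≡j⇒i-j≡0 (trans (sym (expansion N α β)) (coeffChi-isAugMonomialExpansion n m ends N α β))))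
    τ ipp)
  existence : (∀ τ → IsIPP n m τ → c τ ≡ χ̄ τ) → IsAugMonomialExpansion n m ends c
  existence c≡χ̄ N α β = trans (coeffChi-isAugMonomialExpansion n m ends N α β)
    (cong sumℤ (map-cong-local (All.tabulate (λ {σ} σ∈ → cong (_*ℤ + coeffM σ N α β) (sym (c≡χ̄ σ (∈-ipps⇒IsIPP n m σ∈)))))))
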